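{- For $n\ge1$, $U_n=\sum_{k\ge0}2^{n-k-1}R_{n-1,k}$, where $U_n$ and $R_{n,k}$ are defined in the context.
   Context: For $n\ge1$, $S_n$ is the set of permutations of $\{0,\dots,n-1\}$ in one-line notation. $S^3_n$ is the set of pairs $\Pi=(\pi^2,\pi^3)$ of elements of $S_n$ (for $n=0$, the empty permutation); its elements are the columns $\Pi_j=(\pi^2_j,\pi^3_j)^T$ with level $\mathrm{lev}(\Pi_j)=\max\{\pi^2_j,\pi^3_j\}$. $\Pi$ is canonical if $\pi^2=01\cdots(n-1)$. $R_{n,k}$ is the number of canonical $\Pi\in S^3_n$ in which exactly $k$ distinct level values are each attained by two elements ($R_{0,0}=1$, $R_{0,k}=0$ for $k\ge1$). $\Pi$ is unimodal if for some $m$, $\mathrm{lev}(\Pi_1)<\dots<\mathrm{lev}(\Pi_m)>\mathrm{lev}(\Pi_{m+1})>\dots>\mathrm{lev}(\Pi_n)$; $U_n$ is the number of unimodal $\Pi\in S^3_n$. -}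

module Defs where

open import Data.Nat using (ℕ; zero; suc; _+_; _*_; _∸_; _^_; _<_; _>_; _⊔_)
open import Data.Nat.Properties using (_≟_; _<?_)
open import Data.List using (List; []; _∷_; map; concatMap; upTo; filter; length; zipWith; take; drop)
open import Data.List.Relation.Unary.Unique.DecPropositional _≟_ using (Unique; unique?)
open import Data.List.Relation.Unary.Linked using (Linked; linked?)
open import Data.List.Relation.Unary.Any using (Any; any?)
open import Data.Product using (_×_; _,_; proj₁; proj₂)
open import Relation.Nullary using (Dec; _×-dec_)
open import Relation.Binary.PropositionalEquality using (_≡_)

words : ℕ → ℕ → List (List ℕ)
words zero    m = [] ∷ []
words (suc k) m = concatMap (λ x → map (x ∷_) (words k m)) (upTo m)

-- S_n : permutations of {0,…,n-1} in one-line notation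
-- (words of length n over {0,…,n-1} with no repeated letter).
-- For n = 0 this is the single empty permutation.
Sn : ℕ → List (List ℕ)
Sn n = filter unique? (words n n)

-- S^3_n : pairs (π², π³) of permutations.
S3 : ℕ → List (List ℕ × List ℕ)
S3 n = concatMap (λ p → map (p ,_) (Sn n)) (Sn n)

canonical : ℕ → List (List ℕ × List ℕ)
canonical n = map (upTo n ,_) (Sn n)

levels : List ℕ × List ℕ → List ℕ
levels (p , q) = zipWith _⊔_ p q

occ : ℕ → List ℕ → ℕ
occ v xs = length (filter (v ≟_) xs)

-- number of distinct level values attained by (exactly) two columns
-- (level values lie in {0,…,n-1})
doubleLevels : ℕ → List ℕ × List ℕ → ℕ
doubleLevels n Π = length (filter (λ v → occ v (levels Π) ≟ 2) (upTo n))

R : ℕ → ℕ → ℕ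
R n k = length (filter (λ Π → doubleLevels n Π ≟ k) (canonical n))

-- Unimodal sequence: for some m with 1 ≤ m ≤ length,
-- x_1 < … < x_m > x_{m+1} > … > x_len.  (index i = m - 1)
Unimodal : List ℕ → Set
Unimodal xs = Any (λ i → Linked _<_ (take (suc i) xs) × Linked _>_ (drop i xs)) (upTo (length xs))

unimodal? : (xs : List ℕ) → Dec (Unimodal xs)
unimodal? xs = any? (λ i → linked? _<?_ (take (suc i) xs) ×-dec linked? (λ a b → b <? a) (drop i xs)) (upTo (length xs))

U : ℕ → ℕ
U n = length (filter (λ Π → unimodal? (levels Π)) (S3 n))

-- Write Π = (p, σ ∘ p). The levels of Π are then the levels L of the canonical pair (id, σ) read in the order p,
-- so U_n counts, summed over σ, the orderings of the positions of L whose level sequence is unimodal.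
-- Each value occurs in L at most twice. Building an ordering by inserting the values from the largest down,
-- a new smallest value can only be placed at an end: a single copy at either end (or alone, if nothing is
-- larger), two copies at the two ends in either order. Hence the count is 2^(number of values present) if the
-- maximum n-1 occurs once, and 0 if it occurs twice. It occurs once exactly when σ fixes n-1; then σ = τ ++ [n-1]
-- with τ ∈ S_{n-1}, the values below n-1 present number n-1-k where k counts the doubled levels of (id, τ),
-- and grouping the τ by k gives the formula.
module Submission where

open import Defs
open import Data.Nat using (ℕ; zero; suc; _+_; _*_; _∸_; _^_; _≤_; _<_; _>_; _⊔_; _⊓_; z≤n; s≤s)
open import Data.Nat.Properties
open import Data.Nat.ListAction using (sum)
open import Data.Nat.ListAction.Properties using (sum-++; sum-↭)
open import Data.List using (List; []; _∷_; _++_; _∷ʳ_; map; upTo; applyUpTo; filter; length; concatMap; replicate; take; drop; zipWith)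
open import Data.List.Properties
  using ( ++-assoc; ∷-injective; ∷ʳ-injective; concatMap-cong; concatMap-map; length-++; length-filter; length-map
        ; length-replicate; length-upTo; length-zipWith; map-++; map-concatMap; map-cong; map-cong-local; map-upTo
        ; map-∘; take++drop≡id; upTo-∷ʳ)
open import Data.List.Membership.Propositional using (_∈_; _∉_; find; lose)
open import Data.List.Membership.Propositional.Properties
  using ( ∈-++⁻; ∈-∃++; ∈-applyUpTo⁻; ∈-concatMap⁺; ∈-concatMap⁻; ∈-filter⁺; ∈-filter⁻; ∈-map⁺; ∈-map⁻
        ; ∈-upTo⁺; ∈-upTo⁻)
open import Data.List.Membership.Propositional.Properties.WithK using (unique∧set⇒bag)
open import Data.List.Relation.Unary.Any using (here; there)
import Data.List.Relation.Unary.Any.Properties as Any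
open import Data.List.Relation.Unary.All as All using (All; []; _∷_)
import Data.List.Relation.Unary.All.Properties as All
open import Data.List.Relation.Unary.AllPairs using (AllPairs)
import Data.List.Relation.Unary.AllPairs.Properties as AllPairs
open import Data.List.Relation.Unary.Linked as Linked using (Linked; [-]; _∷_)
open import Data.List.Relation.Unary.Unique.Propositional using (Unique; []; _∷_)
open import Data.List.Relation.Unary.Unique.DecPropositional _≟_ using (unique?)
import Data.List.Relation.Unary.Unique.Propositional.Properties as Unique
open import Data.List.Relation.Binary.Subset.Propositional using (_⊆_)
open import Data.List.Relation.Binary.Permutation.Propositional using (_↭_; ↭-refl; ↭-sym; ↭-trans; ↭-prep; ↭⇒↭ₛ)
open import Data.List.Relation.Binary.Permutation.Propositional.Properties as ↭
  using (All-resp-↭; ∈-resp-↭; ↭-length; ↭-empty-inv; drop-∷; shift)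
import Data.List.Relation.Binary.Permutation.Setoid.Properties as SetoidPermutation
open import Data.List.Relation.Binary.BagAndSetEquality using (∼bag⇒↭)
open import Data.Product using (∃; ∃₂; _×_; _,_; proj₁; proj₂)
open import Data.Sum using (_⊎_; inj₁; inj₂)
open import Data.Empty using (⊥-elim)
open import Function using (_∘_; id; mk⇔)
open import Relation.Nullary using (Dec; yes; no; ¬_)
open import Relation.Unary using (Pred; Decidable)
open import Relation.Binary.PropositionalEquality using (_≡_; _≢_; refl; sym; trans; cong; cong₂; subst; setoid; module ≡-Reasoning)
open import Algebra.Properties.CommutativeSemigroup +-commutativeSemigroup using (interchange)
open import Level using (Level)

private variable
  a b p : Level
  A B : Set a

∑ : (A → ℕ) → List A → ℕ
∑ f xs = sum (map f xs)

infix 5 ∑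
syntax ∑ (λ x → e) xs = ∑[ x ∈ xs ] e

∑-++ : (f : A → ℕ) (xs ys : List A) → ∑ f (xs ++ ys) ≡ ∑ f xs + ∑ f ys
∑-++ f xs ys = trans (cong sum (map-++ f xs ys)) (sum-++ (map f xs) (map f ys))

∑-∷ʳ : (f : A → ℕ) (xs : List A) (x : A) → ∑ f (xs ∷ʳ x) ≡ ∑ f xs + f x
∑-∷ʳ f xs x = trans (∑-++ f xs (x ∷ [])) (cong (∑ f xs +_) (+-identityʳ (f x)))

∑-map : (f : B → ℕ) (g : A → B) (xs : List A) → ∑ f (map g xs) ≡ ∑ (f ∘ g) xs
∑-map f g xs = cong sum (sym (map-∘ xs))

∑-concatMap : (f : B → ℕ) (g : A → List B) (xs : List A) → ∑ f (concatMap g xs) ≡ ∑[ x ∈ xs ] ∑ f (g x)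
∑-concatMap f g []       = refl
∑-concatMap f g (x ∷ xs) = trans (∑-++ f (g x) (concatMap g xs)) (cong (∑ f (g x) +_) (∑-concatMap f g xs))

∑-cong : {f g : A → ℕ} (xs : List A) → (∀ {x} → x ∈ xs → f x ≡ g x) → ∑ f xs ≡ ∑ g xs
∑-cong []       f≡g = refl
∑-cong (x ∷ xs) f≡g = cong₂ _+_ (f≡g (here refl)) (∑-cong xs (f≡g ∘ there))

∑-zero : {f : A → ℕ} (xs : List A) → (∀ {x} → x ∈ xs → f x ≡ 0) → ∑ f xs ≡ 0
∑-zero []       f≡0 = refl
∑-zero (x ∷ xs) f≡0 = cong₂ _+_ (f≡0 (here refl)) (∑-zero xs (f≡0 ∘ there))

∑-↭ : (f : A → ℕ) {xs ys : List A} → xs ↭ ys → ∑ f xs ≡ ∑ f ys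
∑-↭ f xs↭ys = sum-↭ (↭.map⁺ f xs↭ys)

∑-+ : (f g : A → ℕ) (xs : List A) → ∑[ x ∈ xs ] (f x + g x) ≡ ∑ f xs + ∑ g xs
∑-+ f g []       = refl
∑-+ f g (x ∷ xs) = trans (cong (f x + g x +_) (∑-+ f g xs)) (interchange (f x) (g x) (∑ f xs) (∑ g xs))

*-distribˡ-∑ : (k : ℕ) (f : A → ℕ) (xs : List A) → k * ∑ f xs ≡ ∑[ x ∈ xs ] k * f x
*-distribˡ-∑ k f []       = *-zeroʳ k
*-distribˡ-∑ k f (x ∷ xs) = trans (*-distribˡ-+ k (f x) (∑ f xs)) (cong (k * f x +_) (*-distribˡ-∑ k f xs))

∑-comm : (h : A → B → ℕ) (xs : List A) (ys : List B) →
         ∑[ x ∈ xs ] ∑[ y ∈ ys ] h x y ≡ ∑[ y ∈ ys ] ∑[ x ∈ xs ] h x y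
∑-comm h []       ys = sym (∑-zero ys (λ _ → refl))
∑-comm h (x ∷ xs) ys = trans (cong (∑ (h x) ys +_) (∑-comm h xs ys)) (sym (∑-+ (h x) _ ys))

∑-const-1 : (xs : List A) → ∑[ x ∈ xs ] 1 ≡ length xs
∑-const-1 []       = refl
∑-const-1 (x ∷ xs) = cong suc (∑-const-1 xs)

𝟙 : {P : Set p} → Dec P → ℕ
𝟙 (yes _) = 1
𝟙 (no _)  = 0

𝟙-yes : {P : Set p} (P? : Dec P) → P → 𝟙 P? ≡ 1
𝟙-yes (yes _) _  = refl
𝟙-yes (no ¬p) p  = ⊥-elim (¬p p)

𝟙-no : {P : Set p} (P? : Dec P) → ¬ P → 𝟙 P? ≡ 0
𝟙-no (yes p) ¬p = ⊥-elim (¬p p)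
𝟙-no (no _)  _  = refl

𝟙-cong : {P : Set a} {Q : Set b} (P? : Dec P) (Q? : Dec Q) → (P → Q) → (Q → P) → 𝟙 P? ≡ 𝟙 Q?
𝟙-cong P? (yes q) _ Q→P = 𝟙-yes P? (Q→P q)
𝟙-cong P? (no ¬q) P→Q _ = 𝟙-no P? (¬q ∘ P→Q)

length-filter≡∑𝟙 : {P : Pred A p} (P? : Decidable P) (xs : List A) → length (filter P? xs) ≡ ∑[ x ∈ xs ] 𝟙 (P? x)
length-filter≡∑𝟙 P? [] = refl
length-filter≡∑𝟙 P? (x ∷ xs) with P? x
... | yes _ = cong suc (length-filter≡∑𝟙 P? xs)
... | no _  = length-filter≡∑𝟙 P? xs

∑-filter : {P : Pred A p} (P? : Decidable P) (f : A → ℕ) (xs : List A) →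
           (∀ {x} → x ∈ xs → ¬ P x → f x ≡ 0) → ∑ f xs ≡ ∑ f (filter P? xs)
∑-filter P? f [] f≡0 = refl
∑-filter P? f (x ∷ xs) f≡0 with P? x
... | yes _  = cong (f x +_) (∑-filter P? f xs (f≡0 ∘ there))
... | no ¬px = trans (cong (_+ ∑ f xs) (f≡0 (here refl) ¬px)) (∑-filter P? f xs (f≡0 ∘ there))

∑-upTo-𝟙≟ : (g : ℕ → ℕ) {x N : ℕ} → x < N → ∑[ k ∈ upTo N ] g k * 𝟙 (x ≟ k) ≡ g x
∑-upTo-𝟙≟ g {x} {suc N} x<1+N = begin
  ∑ term (upTo (suc N))          ≡⟨ cong (∑ term) (sym (upTo-∷ʳ N)) ⟩
  ∑ term (upTo N ∷ʳ N)           ≡⟨ ∑-∷ʳ term (upTo N) N ⟩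
  ∑ term (upTo N) + term N       ≡⟨ split (m≤n⇒m<n∨m≡n (≤-pred x<1+N)) ⟩
  g x                            ∎
  where
  open ≡-Reasoning
  term : ℕ → ℕ
  term k = g k * 𝟙 (x ≟ k)
  off : ∀ {k} → ¬ x ≡ k → term k ≡ 0
  off {k} x≢k = trans (cong (g k *_) (𝟙-no (x ≟ k) x≢k)) (*-zeroʳ (g k))
  split : x < N ⊎ x ≡ N → ∑ term (upTo N) + term N ≡ g x
  split (inj₁ x<N)  = trans (cong₂ _+_ (∑-upTo-𝟙≟ g x<N) (off (<⇒≢ x<N))) (+-identityʳ (g x))
  split (inj₂ refl) = cong₂ _+_ (∑-zero (upTo N) (λ k∈ → off (λ x≡k → <⇒≢ (∈-upTo⁻ k∈) (sym x≡k))))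
                                (trans (cong (g x *_) (𝟙-yes (x ≟ x) refl)) (*-identityʳ (g x)))

∑-upTo-ends : (f : ℕ → ℕ) (M : ℕ) → (∀ {i} → 0 < i → i ≤ M → f i ≡ 0) →
              ∑ f (upTo (suc (suc M))) ≡ f 0 + f (suc M)
∑-upTo-ends f M interior≡0 = begin
  ∑ f (upTo (suc (suc M)))                 ≡⟨ cong (∑ f) (sym (upTo-∷ʳ (suc M))) ⟩
  ∑ f (upTo (suc M) ∷ʳ suc M)              ≡⟨ ∑-∷ʳ f (upTo (suc M)) (suc M) ⟩
  f 0 + ∑ f (applyUpTo suc M) + f (suc M)  ≡⟨ cong (λ s → f 0 + s + f (suc M)) (∑-zero (applyUpTo suc M) interior) ⟩
  f 0 + 0 + f (suc M)                      ≡⟨ cong (_+ f (suc M)) (+-identityʳ (f 0)) ⟩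
  f 0 + f (suc M)                          ∎
  where
  open ≡-Reasoning
  interior : ∀ {i} → i ∈ applyUpTo suc M → f i ≡ 0
  interior i∈ with ∈-applyUpTo⁻ suc i∈
  ... | j , j<M , refl = interior≡0 (s≤s z≤n) j<M

Unique-resp-↭ : {xs ys : List A} → xs ↭ ys → Unique xs → Unique ys
Unique-resp-↭ {A = A} xs↭ys = SetoidPermutation.Unique-resp-↭ (setoid A) (↭⇒↭ₛ xs↭ys)

∈⇒↭∷ : {x : A} {ys : List A} → x ∈ ys → ∃ λ zs → ys ↭ x ∷ zs
∈⇒↭∷ {x = x} x∈ys with ∈-∃++ x∈ys
... | as , bs , refl = as ++ bs , shift x as bs

∈-∷-≢ : {x z : A} {ys : List A} → z ∈ x ∷ ys → z ≢ x → z ∈ ys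
∈-∷-≢ (here z≡x)  z≢x = ⊥-elim (z≢x z≡x)
∈-∷-≢ (there z∈) _   = z∈

∉∧∈⇒≢ : {x z : A} {xs : List A} → x ∉ xs → z ∈ xs → z ≢ x
∉∧∈⇒≢ x∉xs z∈xs refl = x∉xs z∈xs

private
  ⊆-tail : {x : A} {xs ys zs : List A} → Unique (x ∷ xs) → x ∷ xs ⊆ ys → ys ↭ x ∷ zs → xs ⊆ zs
  ⊆-tail u ⊆ys ys↭ z∈ = ∈-∷-≢ (∈-resp-↭ ys↭ (⊆ys (there z∈))) (∉∧∈⇒≢ (Unique.Unique[x∷xs]⇒x∉xs u) z∈)

Unique∧⊆⇒length≤ : {xs ys : List A} → Unique xs → xs ⊆ ys → length xs ≤ length ys
Unique∧⊆⇒length≤ {xs = []}     _ _   = z≤n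
Unique∧⊆⇒length≤ {xs = x ∷ xs} u@(_ ∷ u′) ⊆ys with ∈⇒↭∷ (⊆ys (here refl))
... | zs , ys↭ = subst (suc (length xs) ≤_) (sym (↭-length ys↭)) (s≤s (Unique∧⊆⇒length≤ u′ (⊆-tail u ⊆ys ys↭)))

Unique∧⊆∧length≥⇒↭ : {xs ys : List A} → Unique xs → xs ⊆ ys → length ys ≤ length xs → xs ↭ ys
Unique∧⊆∧length≥⇒↭ {xs = []}     {[]}    _ _ _ = ↭-refl
Unique∧⊆∧length≥⇒↭ {xs = x ∷ xs} u@(_ ∷ u′) ⊆ys ys≤ with ∈⇒↭∷ (⊆ys (here refl))
... | zs , ys↭ = ↭-trans (↭-prep x (Unique∧⊆∧length≥⇒↭ u′ (⊆-tail u ⊆ys ys↭) zs≤)) (↭-sym ys↭)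
  where
  zs≤ : length zs ≤ length xs
  zs≤ = ≤-pred (subst (_≤ suc (length xs)) (↭-length ys↭) ys≤)

Unique∧⊆∧⊇⇒↭ : {xs ys : List A} → Unique xs → Unique ys → xs ⊆ ys → ys ⊆ xs → xs ↭ ys
Unique∧⊆∧⊇⇒↭ uxs uys xs⊆ys ys⊆xs = ∼bag⇒↭ (unique∧set⇒bag uxs uys (mk⇔ xs⊆ys ys⊆xs))

∈-concatMap-∃ : (f : A → List B) (xs : List A) {y : B} → y ∈ concatMap f xs → ∃ λ x → x ∈ xs × y ∈ f x
∈-concatMap-∃ f xs = find ∘ ∈-concatMap⁻ f {xs}

∈-concatMap-intro : (f : A → List B) {xs : List A} {x : A} {y : B} → x ∈ xs → y ∈ f x → y ∈ concatMap f xs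
∈-concatMap-intro f x∈ y∈ = ∈-concatMap⁺ f (lose x∈ y∈)

Unique-concatMap : (f : A → List B) (key : B → A) {xs : List A} → Unique xs →
                   (∀ {x} → x ∈ xs → Unique (f x)) →
                   (∀ {x z} → x ∈ xs → z ∈ f x → key z ≡ x) → Unique (concatMap f xs)
Unique-concatMap f key {[]}     _        _   _   = []
Unique-concatMap f key {x ∷ xs} u@(_ ∷ u′) uf key≡ =
  Unique.++⁺ (uf (here refl)) (Unique-concatMap f key u′ (uf ∘ there) (key≡ ∘ there)) disjoint
  where
  disjoint : ∀ {z} → ¬ (z ∈ f x × z ∈ concatMap f xs)
  disjoint (z∈fx , z∈rest) with ∈-concatMap-∃ f xs z∈rest
  ... | x′ , x′∈ , z∈fx′ = ∉∧∈⇒≢ (Unique.Unique[x∷xs]⇒x∉xs u) x′∈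
                             (trans (sym (key≡ (there x′∈) z∈fx′)) (key≡ (here refl) z∈fx))

Unique-map-local : (f : A → B) {xs : List A} → Unique xs →
                   (∀ {x y} → x ∈ xs → y ∈ xs → f x ≡ f y → x ≡ y) → Unique (map f xs)
Unique-map-local f {[]}     _         _   = []
Unique-map-local f {x ∷ xs} (x∉ ∷ u) inj =
  All.tabulate fresh ∷ Unique-map-local f u (λ p q → inj (there p) (there q))
  where
  fresh : ∀ {y} → y ∈ map f xs → f x ≢ y
  fresh y∈ fx≡y with ∈-map⁻ f y∈
  ... | x′ , x′∈ , refl = All.lookup x∉ x′∈ (inj (here refl) (there x′∈) fx≡y)

map-≡⇒pointwise : {f g : A → B} {xs : List A} → map f xs ≡ map g xs → ∀ {x} → x ∈ xs → f x ≡ g x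
map-≡⇒pointwise {xs = _ ∷ _} ≡ (here refl) = proj₁ (∷-injective ≡)
map-≡⇒pointwise {xs = _ ∷ _} ≡ (there x∈)  = map-≡⇒pointwise (proj₂ (∷-injective ≡)) x∈

-- Entry i of a list, with junk value 0 out of range; at σ is σ viewed as a function.
at : List ℕ → ℕ → ℕ
at []       _       = 0
at (x ∷ xs) zero    = x
at (x ∷ xs) (suc i) = at xs i

at-∈ : (xs : List ℕ) {i : ℕ} → i < length xs → at xs i ∈ xs
at-∈ (x ∷ xs) {zero}  _       = here refl
at-∈ (x ∷ xs) {suc i} (s≤s i<) = there (at-∈ xs i<)

∈⇒∃at : {x : ℕ} (xs : List ℕ) → x ∈ xs → ∃ λ i → i < length xs × at xs i ≡ x
∈⇒∃at (x ∷ xs) (here refl) = 0 , s≤s z≤n , refl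
∈⇒∃at (y ∷ xs) (there x∈) with ∈⇒∃at xs x∈
... | i , i< , at≡ = suc i , s≤s i< , at≡

at-zipWith : (f : ℕ → ℕ → ℕ) (xs ys : List ℕ) {i : ℕ} → i < length xs → i < length ys →
             at (zipWith f xs ys) i ≡ f (at xs i) (at ys i)
at-zipWith f (x ∷ xs) (y ∷ ys) {zero}  _         _         = refl
at-zipWith f (x ∷ xs) (y ∷ ys) {suc i} (s≤s i<) (s≤s i<′) = at-zipWith f xs ys i< i<′

at-applyUpTo : (f : ℕ → ℕ) (n : ℕ) {i : ℕ} → i < n → at (applyUpTo f n) i ≡ f i
at-applyUpTo f (suc n) {zero}  _       = refl
at-applyUpTo f (suc n) {suc i} (s≤s i<) = at-applyUpTo (λ j → f (suc j)) n i<

at-upTo : (n : ℕ) {i : ℕ} → i < n → at (upTo n) i ≡ i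
at-upTo = at-applyUpTo id

map-at-upTo : (xs : List ℕ) → map (at xs) (upTo (length xs)) ≡ xs
map-at-upTo xs = trans (map-upTo (at xs) (length xs)) (applyUpTo-at xs)
  where
  applyUpTo-at : (xs : List ℕ) → applyUpTo (at xs) (length xs) ≡ xs
  applyUpTo-at []       = refl
  applyUpTo-at (x ∷ xs) = cong (x ∷_) (applyUpTo-at xs)

at-injective : {xs : List ℕ} → Unique xs → {i j : ℕ} → i < length xs → j < length xs → at xs i ≡ at xs j → i ≡ j
at-injective {x ∷ xs} _        {zero}  {zero}  _       _       _ = refl
at-injective {x ∷ xs} (x∉ ∷ _) {zero}  {suc j} _       (s≤s j<) x≡ = ⊥-elim (All.lookup x∉ (at-∈ xs j<) x≡)
at-injective {x ∷ xs} (x∉ ∷ _) {suc i} {zero}  (s≤s i<) _       ≡x = ⊥-elim (All.lookup x∉ (at-∈ xs i<) (sym ≡x))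
at-injective {x ∷ xs} (_ ∷ u)  {suc i} {suc j} (s≤s i<) (s≤s j<) ≡  = cong suc (at-injective u i< j< ≡)

at-extensional : (xs ys : List ℕ) → length xs ≡ length ys → (∀ {i} → i < length xs → at xs i ≡ at ys i) → xs ≡ ys
at-extensional []       []       _   _   = refl
at-extensional (x ∷ xs) (y ∷ ys) len at≡ =
  cong₂ _∷_ (at≡ (s≤s z≤n)) (at-extensional xs ys (suc-injective len) (λ i< → at≡ (s≤s i<)))

record IsPermutation (n : ℕ) (p : List ℕ) : Set where
  field
    length≡ : length p ≡ n
    bounded : All (_< n) p
    unique  : Unique p

open IsPermutation

∈-words : (k m : ℕ) {w : List ℕ} → w ∈ words k m → length w ≡ k × All (_< m) w
∈-words zero    m (here refl) = refl , []
∈-words (suc k) m w∈ with ∈-concatMap-∃ (λ x → map (x ∷_) (words k m)) (upTo m) w∈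
... | x , x∈ , w∈′ with ∈-map⁻ (x ∷_) w∈′
... | w′ , w′∈ , refl with ∈-words k m w′∈
... | len , bnd = cong suc len , ∈-upTo⁻ x∈ ∷ bnd

words-∋ : (k m : ℕ) {w : List ℕ} → length w ≡ k → All (_< m) w → w ∈ words k m
words-∋ zero    m {[]}    refl [] = here refl
words-∋ (suc k) m {x ∷ w} len (x< ∷ bnd) =
  ∈-concatMap-intro (λ x → map (x ∷_) (words k m)) (∈-upTo⁺ x<) (∈-map⁺ (x ∷_) (words-∋ k m (suc-injective len) bnd))

Unique-words : (k m : ℕ) → Unique (words k m)
Unique-words zero    m = [] ∷ []
Unique-words (suc k) m = Unique-concatMap (λ x → map (x ∷_) (words k m)) head (Unique.upTo⁺ m)
  (λ {x} _ → Unique.map⁺ {f = x ∷_} (λ x∷≡ → proj₂ (∷-injective x∷≡)) (Unique-words k m))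
  head-block
  where
  head : List ℕ → ℕ
  head []      = 0
  head (x ∷ _) = x
  head-block : ∀ {x z} → x ∈ upTo m → z ∈ map (x ∷_) (words k m) → head z ≡ x
  head-block {x} _ z∈ with ∈-map⁻ (x ∷_) z∈
  ... | _ , _ , refl = refl

∈Sn⇒IsPermutation : (n : ℕ) {p : List ℕ} → p ∈ Sn n → IsPermutation n p
∈Sn⇒IsPermutation n p∈ with ∈-filter⁻ unique? p∈
... | p∈words , u with ∈-words n n p∈words
... | len , bnd = record { length≡ = len ; bounded = bnd ; unique = u }

IsPermutation⇒∈Sn : (n : ℕ) {p : List ℕ} → IsPermutation n p → p ∈ Sn n
IsPermutation⇒∈Sn n π = ∈-filter⁺ unique? (words-∋ n n (length≡ π) (bounded π)) (unique π)

Unique-Sn : (n : ℕ) → Unique (Sn n)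
Unique-Sn n = Unique.filter⁺ unique? (Unique-words n n)

upTo-bounded : (n : ℕ) → All (_< n) (upTo n)
upTo-bounded n = All.tabulate ∈-upTo⁻

IsPermutation⇒↭upTo : (n : ℕ) {p : List ℕ} → IsPermutation n p → p ↭ upTo n
IsPermutation⇒↭upTo n {p} π = Unique∧⊆∧length≥⇒↭ (unique π) (λ x∈ → ∈-upTo⁺ (All.lookup (bounded π) x∈))
  (≤-reflexive (trans (length-upTo n) (sym (length≡ π))))

↭upTo⇒IsPermutation : (n : ℕ) {p : List ℕ} → p ↭ upTo n → IsPermutation n p
↭upTo⇒IsPermutation n p↭ = record
  { length≡ = trans (↭-length p↭) (length-upTo n)
  ; bounded = All-resp-↭ (↭-sym p↭) (upTo-bounded n)
  ; unique  = Unique-resp-↭ (↭-sym p↭) (Unique.upTo⁺ n)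
  }

-- Permutations of a list by insertion

insertAt : List ℕ → ℕ → ℕ → List ℕ
insertAt u i x = take i u ++ x ∷ drop i u

insertions : ℕ → List ℕ → List (List ℕ)
insertions x u = map (λ i → insertAt u i x) (upTo (suc (length u)))

permutations : List ℕ → List (List ℕ)
permutations []       = [] ∷ []
permutations (x ∷ xs) = concatMap (insertions x) (permutations xs)

insertAt-↭ : (u : List ℕ) (i x : ℕ) → insertAt u i x ↭ x ∷ u
insertAt-↭ u i x = subst (λ v → insertAt u i x ↭ x ∷ v) (take++drop≡id i u) (shift x (take i u) (drop i u))

insertAt-++ : (as bs : List ℕ) (x : ℕ) → insertAt (as ++ bs) (length as) x ≡ as ++ x ∷ bs
insertAt-++ []       bs x = refl
insertAt-++ (a ∷ as) bs x = cong (a ∷_) (insertAt-++ as bs x)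

insertAt-length : (u : List ℕ) (x : ℕ) → insertAt u (length u) x ≡ u ∷ʳ x
insertAt-length []      x = refl
insertAt-length (y ∷ u) x = cong (y ∷_) (insertAt-length u x)

∈-insertions⁻ : {x : ℕ} {u v : List ℕ} → v ∈ insertions x u → ∃ λ i → i < suc (length u) × v ≡ insertAt u i x
∈-insertions⁻ {x} {u} v∈ with ∈-map⁻ (λ i → insertAt u i x) v∈
... | i , i∈ , v≡ = i , ∈-upTo⁻ i∈ , v≡

∈-insertions⁺ : {x i : ℕ} {u : List ℕ} → i < suc (length u) → insertAt u i x ∈ insertions x u
∈-insertions⁺ {x} {i} {u} i< = ∈-map⁺ (λ i → insertAt u i x) (∈-upTo⁺ i<)

∈-permutations⇒↭ : (xs : List ℕ) {v : List ℕ} → v ∈ permutations xs → v ↭ xs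
∈-permutations⇒↭ []       (here refl) = ↭-refl
∈-permutations⇒↭ (x ∷ xs) v∈ with ∈-concatMap-∃ (insertions x) (permutations xs) v∈
... | u , u∈ , v∈′ with ∈-insertions⁻ v∈′
... | i , _ , refl = ↭-trans (insertAt-↭ u i x) (↭-prep x (∈-permutations⇒↭ xs u∈))

↭⇒∈-permutations : (xs : List ℕ) {v : List ℕ} → v ↭ xs → v ∈ permutations xs
↭⇒∈-permutations []       v↭ with ↭-empty-inv v↭
... | refl = here refl
↭⇒∈-permutations (x ∷ xs) {v} v↭ with ∈-∃++ (∈-resp-↭ (↭-sym v↭) (here refl))
... | as , bs , refl = ∈-concatMap-intro (insertions x) (↭⇒∈-permutations xs rest↭) v∈
  where
  rest↭ : as ++ bs ↭ xs
  rest↭ = drop-∷ (↭-trans (↭-sym (shift x as bs)) v↭)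
  as< : length as < suc (length (as ++ bs))
  as< = s≤s (subst (length as ≤_) (sym (length-++ as)) (m≤m+n (length as) (length bs)))
  v∈ : as ++ x ∷ bs ∈ insertions x (as ++ bs)
  v∈ = subst (_∈ insertions x (as ++ bs)) (insertAt-++ as bs x) (∈-insertions⁺ as<)

delete : ℕ → List ℕ → List ℕ
delete x []       = []
delete x (y ∷ ys) with y ≟ x
... | yes _ = ys
... | no _  = y ∷ delete x ys

delete-insertAt : (u : List ℕ) (i x : ℕ) → x ∉ u → delete x (insertAt u i x) ≡ u
delete-insertAt u       zero    x _ with x ≟ x
... | yes _   = refl
... | no x≢x  = ⊥-elim (x≢x refl)
delete-insertAt []      (suc i) x _ with x ≟ x
... | yes _   = refl
... | no x≢x  = ⊥-elim (x≢x refl)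
delete-insertAt (y ∷ u) (suc i) x x∉ with y ≟ x
... | yes refl = ⊥-elim (x∉ (here refl))
... | no _     = cong (y ∷_) (delete-insertAt u i x (x∉ ∘ there))

insertAt-injective : (u : List ℕ) (x : ℕ) → x ∉ u → {i j : ℕ} → i < suc (length u) → j < suc (length u) →
                     insertAt u i x ≡ insertAt u j x → i ≡ j
insertAt-injective u       x x∉ {zero}  {zero}  _        _        _  = refl
insertAt-injective []      x x∉ {zero}  {suc j} _        (s≤s ()) _
insertAt-injective (y ∷ u) x x∉ {zero}  {suc j} _        _        ≡  = ⊥-elim (x∉ (here (proj₁ (∷-injective ≡))))
insertAt-injective []      x x∉ {suc i} {_}     (s≤s ()) _        _
insertAt-injective (y ∷ u) x x∉ {suc i} {zero}  _        _        ≡  = ⊥-elim (x∉ (here (sym (proj₁ (∷-injective ≡)))))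
insertAt-injective (y ∷ u) x x∉ {suc i} {suc j} (s≤s i<) (s≤s j<) ≡  =
  cong suc (insertAt-injective u x (x∉ ∘ there) i< j< (proj₂ (∷-injective ≡)))

Unique-permutations : (xs : List ℕ) → Unique xs → Unique (permutations xs)
Unique-permutations []       _            = [] ∷ []
Unique-permutations (x ∷ xs) u@(_ ∷ u′) =
  Unique-concatMap (insertions x) (delete x) (Unique-permutations xs u′) unique-block delete-block
  where
  x∉ : ∀ {w} → w ∈ permutations xs → x ∉ w
  x∉ w∈ x∈w = Unique.Unique[x∷xs]⇒x∉xs u (∈-resp-↭ (∈-permutations⇒↭ xs w∈) x∈w)
  unique-block : ∀ {w} → w ∈ permutations xs → Unique (insertions x w)
  unique-block {w} w∈ = Unique-map-local (λ i → insertAt w i x) (Unique.upTo⁺ _)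
    (λ i∈ j∈ → insertAt-injective w x (x∉ w∈) (∈-upTo⁻ i∈) (∈-upTo⁻ j∈))
  delete-block : ∀ {w z} → w ∈ permutations xs → z ∈ insertions x w → delete x z ≡ w
  delete-block {w} w∈ z∈ with ∈-insertions⁻ z∈
  ... | i , _ , refl = delete-insertAt w i x (x∉ w∈)

map-insertAt : (f : ℕ → ℕ) (u : List ℕ) (i x : ℕ) → map f (insertAt u i x) ≡ insertAt (map f u) i (f x)
map-insertAt f u       zero    x = refl
map-insertAt f []      (suc i) x = refl
map-insertAt f (y ∷ u) (suc i) x = cong (f y ∷_) (map-insertAt f u i x)

map-insertions : (f : ℕ → ℕ) (x : ℕ) (u : List ℕ) → map (map f) (insertions x u) ≡ insertions (f x) (map f u)
map-insertions f x u = begin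
  map (map f) (map (λ i → insertAt u i x) (upTo (suc (length u))))
    ≡⟨ sym (map-∘ (upTo (suc (length u)))) ⟩
  map (λ i → map f (insertAt u i x)) (upTo (suc (length u)))
    ≡⟨ map-cong (λ i → map-insertAt f u i x) (upTo (suc (length u))) ⟩
  map (λ i → insertAt (map f u) i (f x)) (upTo (suc (length u)))
    ≡⟨ cong (λ n → map (λ i → insertAt (map f u) i (f x)) (upTo (suc n))) (sym (length-map f u)) ⟩
  insertions (f x) (map f u) ∎
  where open ≡-Reasoning

map-permutations : (f : ℕ → ℕ) (xs : List ℕ) → map (map f) (permutations xs) ≡ permutations (map f xs)
map-permutations f []       = refl
map-permutations f (x ∷ xs) = begin
  map (map f) (concatMap (insertions x) (permutations xs))      ≡⟨ map-concatMap (map f) (insertions x) (permutations xs) ⟩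
  concatMap (map (map f) ∘ insertions x) (permutations xs)      ≡⟨ concatMap-cong (map-insertions f x) (permutations xs) ⟩
  concatMap (insertions (f x) ∘ map f) (permutations xs)        ≡⟨ sym (concatMap-map (insertions (f x)) (map f) (permutations xs)) ⟩
  concatMap (insertions (f x)) (map (map f) (permutations xs))  ≡⟨ cong (concatMap (insertions (f x))) (map-permutations f xs) ⟩
  concatMap (insertions (f x)) (permutations (map f xs))        ∎
  where open ≡-Reasoning

-- Unimodal sequences

data UpDown : List ℕ → Set where
  down : ∀ {x xs} → Linked _>_ (x ∷ xs) → UpDown (x ∷ xs)
  up   : ∀ {x y xs} → x < y → UpDown (y ∷ xs) → UpDown (x ∷ y ∷ xs)

private
  peak⇒UpDown : (xs : List ℕ) (i : ℕ) → i < length xs →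
                Linked _<_ (take (suc i) xs) → Linked _>_ (drop i xs) → UpDown xs
  peak⇒UpDown (x ∷ xs)     zero    _         _          desc = down desc
  peak⇒UpDown (x ∷ y ∷ ys) (suc i) (s≤s i<) (x<y ∷ asc) desc = up x<y (peak⇒UpDown (y ∷ ys) i i< asc desc)

  UpDown⇒peak : {xs : List ℕ} → UpDown xs →
                ∃ λ i → i < length xs × Linked _<_ (take (suc i) xs) × Linked _>_ (drop i xs)
  UpDown⇒peak (down desc) = 0 , s≤s z≤n , [-] , desc
  UpDown⇒peak (up x<y ud) with UpDown⇒peak ud
  ... | i , i< , asc , desc = suc i , s≤s i< , x<y ∷ asc , desc

Unimodal⇒UpDown : {xs : List ℕ} → Unimodal xs → UpDown xs
Unimodal⇒UpDown {xs} uni with Any.applyUpTo⁻ id uni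
... | i , i< , asc , desc = peak⇒UpDown xs i i< asc desc

UpDown⇒Unimodal : {xs : List ℕ} → UpDown xs → Unimodal xs
UpDown⇒Unimodal ud with UpDown⇒peak ud
... | i , i< , asc , desc = Any.applyUpTo⁺ id (asc , desc) i<

unimodal𝟙 : List ℕ → ℕ
unimodal𝟙 xs = 𝟙 (unimodal? xs)

unimodal𝟙-cong : {xs ys : List ℕ} → (UpDown xs → UpDown ys) → (UpDown ys → UpDown xs) → unimodal𝟙 xs ≡ unimodal𝟙 ys
unimodal𝟙-cong {xs} {ys} xs⇒ys ys⇒xs =
  𝟙-cong (unimodal? xs) (unimodal? ys) (UpDown⇒Unimodal ∘ xs⇒ys ∘ Unimodal⇒UpDown) (UpDown⇒Unimodal ∘ ys⇒xs ∘ Unimodal⇒UpDown)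

unimodal𝟙-no : {xs : List ℕ} → ¬ UpDown xs → unimodal𝟙 xs ≡ 0
unimodal𝟙-no {xs} ¬ud = 𝟙-no (unimodal? xs) (¬ud ∘ Unimodal⇒UpDown)

unimodal𝟙-[] : unimodal𝟙 [] ≡ 0
unimodal𝟙-[] = unimodal𝟙-no {[]} (λ ())

unimodal𝟙-∷-min : {v y : ℕ} {ys : List ℕ} → v < y → unimodal𝟙 (v ∷ y ∷ ys) ≡ unimodal𝟙 (y ∷ ys)
unimodal𝟙-∷-min {v} {y} {ys} v<y = unimodal𝟙-cong tail (up v<y)
  where
  tail : UpDown (v ∷ y ∷ ys) → UpDown (y ∷ ys)
  tail (down (v>y ∷ _)) = ⊥-elim (<-asym v<y v>y)
  tail (up _ ud)        = ud

unimodal𝟙-∷ʳ-min : {v y : ℕ} (ys : List ℕ) → All (v <_) (y ∷ ys) → unimodal𝟙 ((y ∷ ys) ∷ʳ v) ≡ unimodal𝟙 (y ∷ ys)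
unimodal𝟙-∷ʳ-min ys v< = unimodal𝟙-cong (init ys) (snoc ys v<)
  where
  snoc-desc : ∀ {v y} ys → All (v <_) (y ∷ ys) → Linked _>_ (y ∷ ys) → Linked _>_ ((y ∷ ys) ∷ʳ v)
  snoc-desc []       (v<y ∷ []) [-]        = v<y ∷ [-]
  snoc-desc (_ ∷ ys) (_ ∷ v<)   (y>y′ ∷ d) = y>y′ ∷ snoc-desc ys v< d
  init-desc : ∀ {v y} ys → Linked _>_ ((y ∷ ys) ∷ʳ v) → Linked _>_ (y ∷ ys)
  init-desc []       _          = [-]
  init-desc (_ ∷ ys) (y>y′ ∷ d) = y>y′ ∷ init-desc ys d
  snoc : ∀ {v y} ys → All (v <_) (y ∷ ys) → UpDown (y ∷ ys) → UpDown ((y ∷ ys) ∷ʳ v)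
  snoc ys       v< (down d)           = down (snoc-desc ys v< d)
  snoc (_ ∷ ys) (_ ∷ v<) (up y<y′ ud) = up y<y′ (snoc ys v< ud)
  init : ∀ {v y} ys → UpDown ((y ∷ ys) ∷ʳ v) → UpDown (y ∷ ys)
  init []       _             = down [-]
  init (_ ∷ ys) (down d)      = down (init-desc (_ ∷ ys) d)
  init (_ ∷ ys) (up y<y′ ud)  = up y<y′ (init ys ud)

valley⇒¬UpDown : {v y z : ℕ} (l r : List ℕ) → All (v ≤_) (y ∷ l) → v ≤ z → ¬ UpDown ((y ∷ l) ++ v ∷ z ∷ r)
valley⇒¬UpDown []       r (v≤y ∷ []) v≤z (down (_ ∷ v>z ∷ _)) = <⇒≱ v>z v≤z
valley⇒¬UpDown []       r (v≤y ∷ []) v≤z (up y<v _)           = <⇒≱ y<v v≤y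
valley⇒¬UpDown (_ ∷ l)  r _          v≤z (down d)             = <⇒≱ (descent-at-v (_ ∷ _ ∷ l) d) v≤z
  where
  descent-at-v : ∀ {v z} l → Linked _>_ (l ++ v ∷ z ∷ r) → v > z
  descent-at-v []      (v>z ∷ _) = v>z
  descent-at-v (_ ∷ l) d         = descent-at-v l (Linked.tail d)
valley⇒¬UpDown (_ ∷ l)  r (_ ∷ v≤)   v≤z (up _ ud)            = valley⇒¬UpDown l r v≤ v≤z ud

private
  drop-<-length : (j : ℕ) (ys : List ℕ) → j < length ys → ∃₂ λ z r → drop j ys ≡ z ∷ r
  drop-<-length zero    (y ∷ ys) _       = y , ys , refl
  drop-<-length (suc j) (y ∷ ys) (s≤s j<) = drop-<-length j ys j<

-- Inserted strictly inside, a minimum v becomes a valley, and stays one if v is also put at either end.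
interior-insertion-¬UpDown : (v y : ℕ) (ys : List ℕ) (j : ℕ) → All (v ≤_) (y ∷ ys) → j < length ys →
  ¬ UpDown (insertAt (y ∷ ys) (suc j) v) × ¬ UpDown (v ∷ insertAt (y ∷ ys) (suc j) v) ×
  ¬ UpDown (insertAt (y ∷ ys) (suc j) v ∷ʳ v)
interior-insertion-¬UpDown v y ys j (v≤y ∷ v≤) j< with drop-<-length j ys j< | All.drop⁺ j v≤
... | z , r , drop≡ | v≤drop rewrite drop≡ with v≤drop
... | v≤z ∷ _ =
    valley⇒¬UpDown (take j ys) r v≤pre v≤z
  , valley⇒¬UpDown (y ∷ take j ys) r (≤-refl ∷ v≤pre) v≤z
  , λ ud → valley⇒¬UpDown (take j ys) (r ∷ʳ v) v≤pre v≤z (subst UpDown (++-assoc (y ∷ take j ys) (v ∷ z ∷ r) (v ∷ [])) ud)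
  where
  v≤pre : All (v ≤_) (y ∷ take j ys)
  v≤pre = v≤y ∷ All.take⁺ j v≤

∑-insertions-minimum : (v y : ℕ) (ys : List ℕ) → All (v ≤_) (y ∷ ys) →
  ∑ unimodal𝟙 (insertions v (y ∷ ys)) ≡ unimodal𝟙 (v ∷ y ∷ ys) + unimodal𝟙 ((y ∷ ys) ∷ʳ v)
∑-insertions-minimum v y ys v≤ = begin
  ∑ unimodal𝟙 (insertions v u)                      ≡⟨ ∑-map unimodal𝟙 (λ i → insertAt u i v) (upTo (suc (length u))) ⟩
  ∑[ i ∈ upTo (suc (length u)) ] unimodal𝟙 (insertAt u i v)
                                                   ≡⟨ ∑-upTo-ends (λ i → unimodal𝟙 (insertAt u i v)) (length ys) interior ⟩
  unimodal𝟙 (v ∷ u) + unimodal𝟙 (insertAt u (length u) v)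
                                                   ≡⟨ cong (λ w → unimodal𝟙 (v ∷ u) + unimodal𝟙 w) (insertAt-length u v) ⟩
  unimodal𝟙 (v ∷ u) + unimodal𝟙 (u ∷ʳ v)            ∎
  where
  open ≡-Reasoning
  u = y ∷ ys
  interior : ∀ {i} → 0 < i → i ≤ length ys → unimodal𝟙 (insertAt u i v) ≡ 0
  interior {suc j} _ j< = unimodal𝟙-no (proj₁ (interior-insertion-¬UpDown v y ys j v≤ j<))

private
  <⇒≤-all : {v : ℕ} {u : List ℕ} → All (v <_) u → All (v ≤_) u
  <⇒≤-all = All.map <⇒≤

unimodal𝟙-both-ends-min : (v y : ℕ) (ys : List ℕ) → All (v <_) (y ∷ ys) →
  unimodal𝟙 (v ∷ (y ∷ ys) ∷ʳ v) ≡ unimodal𝟙 (y ∷ ys)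
unimodal𝟙-both-ends-min v y ys v<@(v<y ∷ _) = trans (unimodal𝟙-∷-min v<y) (unimodal𝟙-∷ʳ-min ys v<)

∑-insertions-strict-minimum : (v y : ℕ) (ys : List ℕ) → All (v <_) (y ∷ ys) →
  ∑ unimodal𝟙 (insertions v (y ∷ ys)) ≡ unimodal𝟙 (y ∷ ys) + unimodal𝟙 (y ∷ ys)
∑-insertions-strict-minimum v y ys v<@(v<y ∷ _) =
  trans (∑-insertions-minimum v y ys (<⇒≤-all v<)) (cong₂ _+_ (unimodal𝟙-∷-min v<y) (unimodal𝟙-∷ʳ-min ys v<))

-- Of the first copy's positions only the two ends survive; the second copy must then go to the other end.
∑-double-insertions-strict-minimum : (v y : ℕ) (ys : List ℕ) → All (v <_) (y ∷ ys) →
  ∑[ w ∈ insertions v (y ∷ ys) ] ∑ unimodal𝟙 (insertions v w) ≡ unimodal𝟙 (y ∷ ys) + unimodal𝟙 (y ∷ ys)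
∑-double-insertions-strict-minimum v y ys v<@(v<y ∷ _) = begin
  ∑[ w ∈ insertions v u ] ∑ unimodal𝟙 (insertions v w)
    ≡⟨ ∑-map (λ w → ∑ unimodal𝟙 (insertions v w)) (λ i → insertAt u i v) (upTo (suc (length u))) ⟩
  ∑ after (upTo (suc (length u)))   ≡⟨ ∑-upTo-ends after (length ys) interior ⟩
  after 0 + after (length u)        ≡⟨ cong₂ _+_ at-front at-back ⟩
  unimodal𝟙 u + unimodal𝟙 u         ∎
  where
  open ≡-Reasoning
  u = y ∷ ys
  after : ℕ → ℕ
  after i = ∑ unimodal𝟙 (insertions v (insertAt u i v))
  v≤ : ∀ i → All (v ≤_) (insertAt u i v)
  v≤ i = All.++⁺ (All.take⁺ i (<⇒≤-all v<)) (≤-refl ∷ All.drop⁺ i (<⇒≤-all v<))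
  interior : ∀ {i} → 0 < i → i ≤ length ys → after i ≡ 0
  interior {suc j} _ j< with interior-insertion-¬UpDown v y ys j (<⇒≤-all v<) j<
  ... | _ , ¬front , ¬back = trans (∑-insertions-minimum v y (take j ys ++ v ∷ drop j ys) (v≤ (suc j)))
                                   (cong₂ _+_ (unimodal𝟙-no ¬front) (unimodal𝟙-no ¬back))
  at-front : after 0 ≡ unimodal𝟙 u
  at-front = begin
    after 0                                           ≡⟨ ∑-insertions-minimum v v u (v≤ 0) ⟩
    unimodal𝟙 (v ∷ v ∷ u) + unimodal𝟙 (v ∷ u ∷ʳ v)    ≡⟨ cong₂ _+_ (unimodal𝟙-no (valley⇒¬UpDown [] ys (≤-refl ∷ []) (<⇒≤ v<y)))
                                                                    (unimodal𝟙-both-ends-min v y ys v<) ⟩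
    0 + unimodal𝟙 u                                   ∎
  at-back : after (length u) ≡ unimodal𝟙 u
  at-back = begin
    after (length u)                                  ≡⟨ cong (λ w → ∑ unimodal𝟙 (insertions v w)) (insertAt-length u v) ⟩
    ∑ unimodal𝟙 (insertions v (u ∷ʳ v))
      ≡⟨ ∑-insertions-minimum v y (ys ∷ʳ v) (subst (All (v ≤_)) (insertAt-length u v) (v≤ (length u))) ⟩
    unimodal𝟙 (v ∷ u ∷ʳ v) + unimodal𝟙 (u ∷ʳ v ∷ʳ v)  ≡⟨ cong₂ _+_ (unimodal𝟙-both-ends-min v y ys v<) (unimodal𝟙-no back-valley) ⟩
    unimodal𝟙 u + 0                                   ≡⟨ +-identityʳ _ ⟩
    unimodal𝟙 u                                       ∎
    where
    back-valley : ¬ UpDown (u ∷ʳ v ∷ʳ v)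
    back-valley ud = valley⇒¬UpDown ys [] (<⇒≤-all v<) ≤-refl (subst UpDown (++-assoc u (v ∷ []) (v ∷ [])) ud)

-- Unimodal arrangements of a multiset

-- withMinimum c m f counts the unimodal arrangements after c copies of a new smallest value join m larger
-- elements, f of whose arrangements are unimodal. For c = 2 and m = 0 the clause is right because then f = 0.
withMinimum : ℕ → ℕ → ℕ → ℕ
withMinimum zero                _       f = f
withMinimum (suc zero)          zero    _ = 1
withMinimum (suc zero)          (suc _) f = f + f
withMinimum (suc (suc zero))    _       f = f + f
withMinimum (suc (suc (suc _))) _       _ = 0

-- The head of the list is the multiplicity of the smallest value.
unimodalArrangements : List ℕ → ℕ
unimodalArrangements []       = 0
unimodalArrangements (c ∷ cs) = withMinimum c (sum cs) (unimodalArrangements cs)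

private
  ∑-nonempty-permutations : (g : List ℕ → ℕ) (r : ℕ) (rs : List ℕ) →
    (∀ {y ys} → y ∷ ys ↭ r ∷ rs → g (y ∷ ys) ≡ unimodal𝟙 (y ∷ ys) + unimodal𝟙 (y ∷ ys)) →
    ∑ g (permutations (r ∷ rs)) ≡ ∑ unimodal𝟙 (permutations (r ∷ rs)) + ∑ unimodal𝟙 (permutations (r ∷ rs))
  ∑-nonempty-permutations g r rs g≡ =
    trans (∑-cong (permutations (r ∷ rs)) pointwise) (∑-+ unimodal𝟙 unimodal𝟙 (permutations (r ∷ rs)))
    where
    pointwise : ∀ {u} → u ∈ permutations (r ∷ rs) → g u ≡ unimodal𝟙 u + unimodal𝟙 u
    pointwise {u} u∈ with u | ∈-permutations⇒↭ (r ∷ rs) u∈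
    ... | []     | []↭ with () ← ↭-length []↭
    ... | y ∷ ys | u↭  = g≡ u↭

∑-unimodal-insert-minimum : (v : ℕ) (R : List ℕ) → All (v <_) R →
  ∑ unimodal𝟙 (permutations (v ∷ R)) ≡ withMinimum 1 (length R) (∑ unimodal𝟙 (permutations R))
∑-unimodal-insert-minimum v []       _  = 𝟙-yes (unimodal? (v ∷ [])) (UpDown⇒Unimodal (down [-]))
∑-unimodal-insert-minimum v (r ∷ rs) v< =
  trans (∑-concatMap unimodal𝟙 (insertions v) (permutations (r ∷ rs)))
        (∑-nonempty-permutations _ r rs (λ {y} {ys} u↭ → ∑-insertions-strict-minimum v y ys (All-resp-↭ (↭-sym u↭) v<)))

¬UpDown-vv : (v : ℕ) → ¬ UpDown (v ∷ v ∷ [])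
¬UpDown-vv v (down (v>v ∷ _)) = <-irrefl refl v>v
¬UpDown-vv v (up v<v _)       = <-irrefl refl v<v

∑-unimodal-insert-two-minima : (v : ℕ) (R : List ℕ) → All (v <_) R →
  ∑ unimodal𝟙 (permutations (v ∷ v ∷ R)) ≡ withMinimum 2 (length R) (∑ unimodal𝟙 (permutations R))
∑-unimodal-insert-two-minima v []       _  rewrite unimodal𝟙-no (¬UpDown-vv v) | unimodal𝟙-[] = refl
∑-unimodal-insert-two-minima v (r ∷ rs) v< = begin
  ∑ unimodal𝟙 (concatMap (insertions v) (concatMap (insertions v) (permutations (r ∷ rs))))
    ≡⟨ ∑-concatMap unimodal𝟙 (insertions v) (concatMap (insertions v) (permutations (r ∷ rs))) ⟩
  ∑[ w ∈ concatMap (insertions v) (permutations (r ∷ rs)) ] ∑ unimodal𝟙 (insertions v w)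
    ≡⟨ ∑-concatMap (λ w → ∑ unimodal𝟙 (insertions v w)) (insertions v) (permutations (r ∷ rs)) ⟩
  ∑[ u ∈ permutations (r ∷ rs) ] ∑[ w ∈ insertions v u ] ∑ unimodal𝟙 (insertions v w)
    ≡⟨ ∑-nonempty-permutations _ r rs (λ {y} {ys} u↭ → ∑-double-insertions-strict-minimum v y ys (All-resp-↭ (↭-sym u↭) v<)) ⟩
  withMinimum 2 (length (r ∷ rs)) (∑ unimodal𝟙 (permutations (r ∷ rs))) ∎
  where open ≡-Reasoning

blocks : (ℕ → ℕ) → List ℕ → List ℕ
blocks c vs = concatMap (λ v → replicate (c v) v) vs

blocks-bounded : (c : ℕ → ℕ) {v : ℕ} (vs : List ℕ) → All (v <_) vs → All (v <_) (blocks c vs)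
blocks-bounded c []       []         = []
blocks-bounded c (w ∷ vs) (v<w ∷ v<) = All.++⁺ (All.replicate⁺ (c w) v<w) (blocks-bounded c vs v<)

length-blocks : (c : ℕ → ℕ) (vs : List ℕ) → length (blocks c vs) ≡ sum (map c vs)
length-blocks c []       = refl
length-blocks c (v ∷ vs) = trans (length-++ (replicate (c v) v)) (cong₂ _+_ (length-replicate (c v)) (length-blocks c vs))

-- Permutations of the sorted multiset are built by inserting its values from the largest block down to the smallest.
∑-unimodal-permutations-blocks : (c : ℕ → ℕ) (vs : List ℕ) → AllPairs _<_ vs → All (λ v → c v ≤ 2) vs →
  ∑ unimodal𝟙 (permutations (blocks c vs)) ≡ unimodalArrangements (map c vs)
∑-unimodal-permutations-blocks c []       _          _            = refl
∑-unimodal-permutations-blocks c (v ∷ vs) (v< ∷ <vs) (cv≤2 ∷ c≤2) with c v | cv≤2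
... | zero               | _ = ∑-unimodal-permutations-blocks c vs <vs c≤2
... | suc zero           | _ = trans (∑-unimodal-insert-minimum v (blocks c vs) (blocks-bounded c vs v<))
                                     (cong₂ (withMinimum 1) (length-blocks c vs) (∑-unimodal-permutations-blocks c vs <vs c≤2))
... | suc (suc zero)     | _ = trans (∑-unimodal-insert-two-minima v (blocks c vs) (blocks-bounded c vs v<))
                                     (cong₂ (withMinimum 2) (length-blocks c vs) (∑-unimodal-permutations-blocks c vs <vs c≤2))
... | suc (suc (suc _))  | s≤s (s≤s ())

Sn↭permutations : (n : ℕ) {xs : List ℕ} → xs ↭ upTo n → Sn n ↭ permutations xs
Sn↭permutations n {xs} xs↭ = Unique∧⊆∧⊇⇒↭ (Unique-Sn n) (Unique-permutations xs (unique xs-perm))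
  (λ p∈ → ↭⇒∈-permutations xs (↭-trans (IsPermutation⇒↭upTo n (∈Sn⇒IsPermutation n p∈)) (↭-sym xs↭)))
  (λ p∈ → IsPermutation⇒∈Sn n (↭upTo⇒IsPermutation n (↭-trans (∈-permutations⇒↭ xs p∈) xs↭)))
  where
  xs-perm : IsPermutation n xs
  xs-perm = ↭upTo⇒IsPermutation n xs↭

multiplicities : ℕ → List ℕ → List ℕ
multiplicities n L = map (λ v → occ v L) (upTo n)

indicesByValue : ℕ → List ℕ → List ℕ
indicesByValue n L = concatMap (λ v → filter (λ i → v ≟ at L i) (upTo n)) (upTo n)

indicesByValue-↭ : (n : ℕ) (L : List ℕ) → length L ≡ n → All (_< n) L → indicesByValue n L ↭ upTo n
indicesByValue-↭ n L len L<n = Unique∧⊆∧⊇⇒↭ unique-indices (Unique.upTo⁺ n) ⊆upTo upTo⊆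
  where
  block : ℕ → List ℕ
  block v = filter (λ i → v ≟ at L i) (upTo n)
  unique-indices : Unique (indicesByValue n L)
  unique-indices = Unique-concatMap block (at L) (Unique.upTo⁺ n) (λ _ → Unique.filter⁺ (λ i → _ ≟ at L i) (Unique.upTo⁺ n))
    (λ {v} _ i∈ → sym (proj₂ (∈-filter⁻ (λ i → v ≟ at L i) {xs = upTo n} i∈)))
  ⊆upTo : indicesByValue n L ⊆ upTo n
  ⊆upTo i∈ with ∈-concatMap-∃ block (upTo n) i∈
  ... | v , _ , i∈block = proj₁ (∈-filter⁻ (λ i → v ≟ at L i) i∈block)
  upTo⊆ : upTo n ⊆ indicesByValue n L
  upTo⊆ {i} i∈ = ∈-concatMap-intro block (∈-upTo⁺ (All.lookup L<n (at-∈ L (subst (i <_) (sym len) (∈-upTo⁻ i∈)))))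
                   (∈-filter⁺ (λ j → at L i ≟ at L j) i∈ refl)

map-filter-fibre : (f : ℕ → ℕ) {v : ℕ} (P? : Decidable (λ i → v ≡ f i)) (is : List ℕ) →
                   map f (filter P? is) ≡ replicate (length (filter P? is)) v
map-filter-fibre f P? []       = refl
map-filter-fibre f P? (i ∷ is) with P? i
... | yes v≡ = cong₂ _∷_ (sym v≡) (map-filter-fibre f P? is)
... | no _   = map-filter-fibre f P? is

map-at-indicesByValue : (n : ℕ) (L : List ℕ) → length L ≡ n → map (at L) (indicesByValue n L) ≡ blocks (λ v → occ v L) (upTo n)
map-at-indicesByValue n L len =
  trans (map-concatMap (at L) block (upTo n)) (concatMap-cong (λ v → trans (map-block v) (cong (λ k → replicate k v) (size v))) (upTo n))
  where
  block : ℕ → List ℕ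
  block v = filter (λ i → v ≟ at L i) (upTo n)
  map-block : ∀ v → map (at L) (block v) ≡ replicate (length (block v)) v
  map-block v = map-filter-fibre (at L) (λ i → v ≟ at L i) (upTo n)
  size : ∀ v → length (block v) ≡ occ v L
  size v = begin
    length (block v)                        ≡⟨ length-filter≡∑𝟙 (λ i → v ≟ at L i) (upTo n) ⟩
    ∑[ i ∈ upTo n ] 𝟙 (v ≟ at L i)          ≡⟨ sym (∑-map (λ x → 𝟙 (v ≟ x)) (at L) (upTo n)) ⟩
    ∑[ x ∈ map (at L) (upTo n) ] 𝟙 (v ≟ x)  ≡⟨ cong (λ n → ∑[ x ∈ map (at L) (upTo n) ] 𝟙 (v ≟ x)) (sym len) ⟩
    ∑[ x ∈ map (at L) (upTo (length L)) ] 𝟙 (v ≟ x) ≡⟨ cong (∑ (λ x → 𝟙 (v ≟ x))) (map-at-upTo L) ⟩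
    ∑[ x ∈ L ] 𝟙 (v ≟ x)                    ≡⟨ sym (length-filter≡∑𝟙 (v ≟_) L) ⟩
    occ v L                                 ∎
    where open ≡-Reasoning

∑-unimodal-relabelled-permutations : (n : ℕ) (L : List ℕ) → length L ≡ n → All (_< n) L → (∀ v → occ v L ≤ 2) →
  ∑[ p ∈ Sn n ] unimodal𝟙 (map (at L) p) ≡ unimodalArrangements (multiplicities n L)
∑-unimodal-relabelled-permutations n L len L<n occ≤2 = begin
  ∑[ p ∈ Sn n ] unimodal𝟙 (map (at L) p)
    ≡⟨ ∑-↭ (unimodal𝟙 ∘ map (at L)) (Sn↭permutations n (indicesByValue-↭ n L len L<n)) ⟩
  ∑[ p ∈ permutations is ] unimodal𝟙 (map (at L) p) ≡⟨ sym (∑-map unimodal𝟙 (map (at L)) (permutations is)) ⟩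
  ∑ unimodal𝟙 (map (map (at L)) (permutations is)) ≡⟨ cong (∑ unimodal𝟙) (map-permutations (at L) is) ⟩
  ∑ unimodal𝟙 (permutations (map (at L) is))       ≡⟨ cong (∑ unimodal𝟙 ∘ permutations) (map-at-indicesByValue n L len) ⟩
  ∑ unimodal𝟙 (permutations (blocks (λ v → occ v L) (upTo n)))
    ≡⟨ ∑-unimodal-permutations-blocks (λ v → occ v L) (upTo n)
         (AllPairs.applyUpTo⁺₁ id n (λ i<j _ → i<j)) (All.tabulate (λ {v} _ → occ≤2 v)) ⟩
  unimodalArrangements (multiplicities n L)        ∎
  where
  open ≡-Reasoning
  is = indicesByValue n L


-- Reduction to canonical pairs

map-at-∈Sn : (n : ℕ) {σ p : List ℕ} → σ ∈ Sn n → p ∈ Sn n → map (at σ) p ∈ Sn n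
map-at-∈Sn n {σ} {p} σ∈ p∈ = IsPermutation⇒∈Sn n record
  { length≡ = trans (length-map (at σ) p) (length≡ πp)
  ; bounded = All.map⁺ (All.map σ-bounded (bounded πp))
  ; unique  = Unique-map-local (at σ) (unique πp) (λ i∈ j∈ → at-injective (unique πσ) (in-σ i∈) (in-σ j∈))
  }
  where
  πσ = ∈Sn⇒IsPermutation n σ∈
  πp = ∈Sn⇒IsPermutation n p∈
  in-σ : ∀ {i} → i ∈ p → i < length σ
  in-σ i∈ = subst (_ <_) (sym (length≡ πσ)) (All.lookup (bounded πp) i∈)
  σ-bounded : ∀ {i} → i < n → at σ i < n
  σ-bounded {i} i<n = All.lookup (bounded πσ) (at-∈ σ (subst (i <_) (sym (length≡ πσ)) i<n))

-- σ ↦ σ ∘ p is a bijection of S_n: it is injective since p is onto, and S_n is finite.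
precompose-↭ : (n : ℕ) {p : List ℕ} → p ∈ Sn n → map (λ σ → map (at σ) p) (Sn n) ↭ Sn n
precompose-↭ n {p} p∈ = Unique∧⊆∧length≥⇒↭ (Unique-map-local _ (Unique-Sn n) injective) image⊆
  (≤-reflexive (sym (length-map _ (Sn n))))
  where
  injective : ∀ {σ τ} → σ ∈ Sn n → τ ∈ Sn n → map (at σ) p ≡ map (at τ) p → σ ≡ τ
  injective {σ} {τ} σ∈ τ∈ σp≡τp = at-extensional σ τ (trans (length≡ πσ) (sym (length≡ (∈Sn⇒IsPermutation n τ∈)))) at≡
    where
    πσ = ∈Sn⇒IsPermutation n σ∈
    at≡ : ∀ {i} → i < length σ → at σ i ≡ at τ i
    at≡ {i} i< = map-≡⇒pointwise σp≡τp (∈-resp-↭ (↭-sym (IsPermutation⇒↭upTo n (∈Sn⇒IsPermutation n p∈)))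
                                                   (∈-upTo⁺ (subst (i <_) (length≡ πσ) i<)))
  image⊆ : ∀ {q} → q ∈ map (λ σ → map (at σ) p) (Sn n) → q ∈ Sn n
  image⊆ q∈ with ∈-map⁻ (λ σ → map (at σ) p) q∈
  ... | σ , σ∈ , refl = map-at-∈Sn n σ∈ p∈

at-levels : (n : ℕ) (σ : List ℕ) → length σ ≡ n → {i : ℕ} → i < n → at (levels (upTo n , σ)) i ≡ i ⊔ at σ i
at-levels n σ len {i} i<n =
  trans (at-zipWith _⊔_ (upTo n) σ (subst (i <_) (sym (length-upTo n)) i<n) (subst (i <_) (sym len) i<n))
        (cong (_⊔ at σ i) (at-upTo n i<n))

levels-precompose : (n : ℕ) {σ p : List ℕ} → σ ∈ Sn n → p ∈ Sn n →
                    levels (p , map (at σ) p) ≡ map (at (levels (upTo n , σ))) p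
levels-precompose n {σ} {p} σ∈ p∈ = trans (zipWith-map p) (map-cong-local (All.tabulate at-level))
  where
  zipWith-map : ∀ xs → zipWith _⊔_ xs (map (at σ) xs) ≡ map (λ i → i ⊔ at σ i) xs
  zipWith-map []       = refl
  zipWith-map (x ∷ xs) = cong (x ⊔ at σ x ∷_) (zipWith-map xs)
  at-level : ∀ {i} → i ∈ p → i ⊔ at σ i ≡ at (levels (upTo n , σ)) i
  at-level i∈ = sym (at-levels n σ (length≡ (∈Sn⇒IsPermutation n σ∈)) (All.lookup (bounded (∈Sn⇒IsPermutation n p∈)) i∈))

U≡∑-canonical : (n : ℕ) → U n ≡ ∑[ σ ∈ Sn n ] ∑[ p ∈ Sn n ] unimodal𝟙 (map (at (levels (upTo n , σ))) p)
U≡∑-canonical n = begin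
  U n                                                          ≡⟨ length-filter≡∑𝟙 (λ Π → unimodal? (levels Π)) (S3 n) ⟩
  ∑[ Π ∈ S3 n ] unimodal𝟙 (levels Π)                           ≡⟨ ∑-concatMap (unimodal𝟙 ∘ levels) (λ p → map (p ,_) (Sn n)) (Sn n) ⟩
  ∑[ p ∈ Sn n ] ∑[ Π ∈ map (p ,_) (Sn n) ] unimodal𝟙 (levels Π) ≡⟨ ∑-cong (Sn n) fixed-p ⟩
  ∑[ p ∈ Sn n ] ∑[ σ ∈ Sn n ] f σ p                            ≡⟨ ∑-comm (λ p σ → f σ p) (Sn n) (Sn n) ⟩
  ∑[ σ ∈ Sn n ] ∑[ p ∈ Sn n ] f σ p                            ∎
  where
  open ≡-Reasoning
  f : List ℕ → List ℕ → ℕ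
  f σ p = unimodal𝟙 (map (at (levels (upTo n , σ))) p)
  fixed-p : ∀ {p} → p ∈ Sn n → ∑[ Π ∈ map (p ,_) (Sn n) ] unimodal𝟙 (levels Π) ≡ ∑[ σ ∈ Sn n ] f σ p
  fixed-p {p} p∈ = begin
    ∑[ Π ∈ map (p ,_) (Sn n) ] unimodal𝟙 (levels Π)            ≡⟨ ∑-map (unimodal𝟙 ∘ levels) (p ,_) (Sn n) ⟩
    ∑[ q ∈ Sn n ] unimodal𝟙 (levels (p , q))                   ≡⟨ ∑-↭ (λ q → unimodal𝟙 (levels (p , q))) (↭-sym (precompose-↭ n p∈)) ⟩
    ∑[ q ∈ map (λ σ → map (at σ) p) (Sn n) ] unimodal𝟙 (levels (p , q))
                                                              ≡⟨ ∑-map (λ q → unimodal𝟙 (levels (p , q))) (λ σ → map (at σ) p) (Sn n) ⟩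
    ∑[ σ ∈ Sn n ] unimodal𝟙 (levels (p , map (at σ) p))        ≡⟨ ∑-cong (Sn n) (λ σ∈ → cong unimodal𝟙 (levels-precompose n σ∈ p∈)) ⟩
    ∑[ σ ∈ Sn n ] f σ p                                        ∎

occ≡∑𝟙 : (v : ℕ) (xs : List ℕ) → occ v xs ≡ ∑[ x ∈ xs ] 𝟙 (v ≟ x)
occ≡∑𝟙 v = length-filter≡∑𝟙 (v ≟_)

occ-∷ʳ : (v : ℕ) (xs : List ℕ) (y : ℕ) → occ v (xs ∷ʳ y) ≡ occ v xs + 𝟙 (v ≟ y)
occ-∷ʳ v xs y =
  trans (occ≡∑𝟙 v (xs ∷ʳ y)) (trans (∑-∷ʳ (λ x → 𝟙 (v ≟ x)) xs y) (cong (_+ 𝟙 (v ≟ y)) (sym (occ≡∑𝟙 v xs))))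

occ-∉ : {v : ℕ} (xs : List ℕ) → v ∉ xs → occ v xs ≡ 0
occ-∉ {v} xs v∉ = trans (occ≡∑𝟙 v xs) (∑-zero xs (λ {x} x∈ → 𝟙-no (v ≟ x) (λ { refl → v∉ x∈ })))

occ-∈ : {v : ℕ} (xs : List ℕ) → v ∈ xs → 1 ≤ occ v xs
occ-∈ {v} xs v∈ = subst (1 ≤_) (sym (occ≡∑𝟙 v xs)) (go xs v∈)
  where
  go : ∀ xs → v ∈ xs → 1 ≤ ∑[ x ∈ xs ] 𝟙 (v ≟ x)
  go (x ∷ xs) (here refl) = subst (λ k → 1 ≤ k + (∑[ x ∈ xs ] 𝟙 (v ≟ x))) (sym (𝟙-yes (v ≟ v) refl)) (s≤s z≤n)
  go (x ∷ xs) (there v∈)  = ≤-trans (go xs v∈) (m≤n+m _ (𝟙 (v ≟ x)))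

occ-Unique : (v : ℕ) {xs : List ℕ} → Unique xs → occ v xs ≤ 1
occ-Unique v {xs} u = subst (_≤ 1) (sym (occ≡∑𝟙 v xs)) (go u)
  where
  go : ∀ {xs} → Unique xs → ∑[ x ∈ xs ] 𝟙 (v ≟ x) ≤ 1
  go {[]}     _          = z≤n
  go {x ∷ xs} u@(_ ∷ u′) with v ≟ x
  ... | yes refl = s≤s (≤-reflexive (trans (sym (occ≡∑𝟙 v xs)) (occ-∉ xs (Unique.Unique[x∷xs]⇒x∉xs u))))
  ... | no _     = go u′

private
  𝟙-≟-⊔ : (v x y : ℕ) → 𝟙 (v ≟ x ⊔ y) ≤ 𝟙 (v ≟ x) + 𝟙 (v ≟ y)
  𝟙-≟-⊔ v x y with v ≟ x ⊔ y | v ≟ x | v ≟ y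
  ... | no _     | _     | _     = z≤n
  ... | yes _    | yes _ | _     = s≤s z≤n
  ... | yes _    | no _  | yes _ = ≤-refl
  ... | yes v≡ | no v≢x | no v≢y with ⊔-sel x y
  ...   | inj₁ ⊔≡x = ⊥-elim (v≢x (trans v≡ ⊔≡x))
  ...   | inj₂ ⊔≡y = ⊥-elim (v≢y (trans v≡ ⊔≡y))

occ-zipWith-⊔ : (v : ℕ) (xs ys : List ℕ) → occ v (zipWith _⊔_ xs ys) ≤ occ v xs + occ v ys
occ-zipWith-⊔ v xs ys = begin
  occ v (zipWith _⊔_ xs ys)                   ≡⟨ occ≡∑𝟙 v (zipWith _⊔_ xs ys) ⟩
  ∑[ x ∈ zipWith _⊔_ xs ys ] 𝟙 (v ≟ x)        ≤⟨ go xs ys ⟩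
  (∑[ x ∈ xs ] 𝟙 (v ≟ x)) + (∑[ y ∈ ys ] 𝟙 (v ≟ y)) ≡⟨ sym (cong₂ _+_ (occ≡∑𝟙 v xs) (occ≡∑𝟙 v ys)) ⟩
  occ v xs + occ v ys                         ∎
  where
  open ≤-Reasoning
  go : ∀ xs ys → ∑[ x ∈ zipWith _⊔_ xs ys ] 𝟙 (v ≟ x) ≤ (∑[ x ∈ xs ] 𝟙 (v ≟ x)) + (∑[ y ∈ ys ] 𝟙 (v ≟ y))
  go []       ys       = z≤n
  go (x ∷ xs) []       = z≤n
  go (x ∷ xs) (y ∷ ys) =
    ≤-trans (+-mono-≤ (𝟙-≟-⊔ v x y) (go xs ys)) (≤-reflexive (interchange (𝟙 (v ≟ x)) (𝟙 (v ≟ y)) _ _))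

∑-occ-upTo : (m : ℕ) (L : List ℕ) → All (_< m) L → ∑[ v ∈ upTo m ] occ v L ≡ length L
∑-occ-upTo m L L<m = begin
  ∑[ v ∈ upTo m ] occ v L                      ≡⟨ ∑-cong (upTo m) (λ {v} _ → occ≡∑𝟙 v L) ⟩
  ∑[ v ∈ upTo m ] ∑[ x ∈ L ] 𝟙 (v ≟ x)         ≡⟨ ∑-comm (λ v x → 𝟙 (v ≟ x)) (upTo m) L ⟩
  ∑[ x ∈ L ] ∑[ v ∈ upTo m ] 𝟙 (v ≟ x)         ≡⟨ ∑-cong L (λ x∈ → hit-once (All.lookup L<m x∈)) ⟩
  ∑[ x ∈ L ] 1                                 ≡⟨ ∑-const-1 L ⟩
  length L                                     ∎
  where
  open ≡-Reasoning
  hit-once : ∀ {x} → x < m → ∑[ v ∈ upTo m ] 𝟙 (v ≟ x) ≡ 1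
  hit-once {x} x<m = trans (∑-cong (upTo m) (λ {v} _ → trans (𝟙-cong (v ≟ x) (x ≟ v) sym sym) (sym (*-identityˡ _))))
                           (∑-upTo-𝟙≟ (λ _ → 1) x<m)

private
  sum-∷ʳ-suc : (cs : List ℕ) (k : ℕ) → sum (cs ∷ʳ suc k) ≡ suc (sum cs + k)
  sum-∷ʳ-suc cs k = trans (sum-++ cs (suc k ∷ [])) (trans (cong (sum cs +_) (+-identityʳ (suc k))) (+-suc (sum cs) k))

  withMinimum-0 : (c s : ℕ) → withMinimum c (suc s) 0 ≡ 0
  withMinimum-0 zero                _ = refl
  withMinimum-0 (suc zero)          _ = refl
  withMinimum-0 (suc (suc zero))    _ = refl
  withMinimum-0 (suc (suc (suc _))) _ = refl

-- A largest value occurring at least twice cannot be the single peak.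
unimodalArrangements-∷ʳ-≥2 : (cs : List ℕ) (c : ℕ) → 2 ≤ c → unimodalArrangements (cs ∷ʳ c) ≡ 0
unimodalArrangements-∷ʳ-≥2 []        (suc zero)          (s≤s ())
unimodalArrangements-∷ʳ-≥2 []        (suc (suc zero))    _ = refl
unimodalArrangements-∷ʳ-≥2 []        (suc (suc (suc _))) _ = refl
unimodalArrangements-∷ʳ-≥2 (c′ ∷ cs) (suc c) 2≤c =
  trans (cong₂ (withMinimum c′) (sum-∷ʳ-suc cs c) (unimodalArrangements-∷ʳ-≥2 cs (suc c) 2≤c)) (withMinimum-0 c′ _)

positives : List ℕ → ℕ
positives cs = ∑[ c ∈ cs ] 𝟙 (0 <? c)

unimodalArrangements-∷ʳ-1 : (cs : List ℕ) → All (_≤ 2) cs → unimodalArrangements (cs ∷ʳ 1) ≡ 2 ^ positives cs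
unimodalArrangements-∷ʳ-1 []        _          = refl
unimodalArrangements-∷ʳ-1 (c ∷ cs) (c≤2 ∷ cs≤2) with c | c≤2
... | zero              | _ = unimodalArrangements-∷ʳ-1 cs cs≤2
... | suc zero          | _ = trans (cong₂ (withMinimum 1) (sum-∷ʳ-suc cs 0) (unimodalArrangements-∷ʳ-1 cs cs≤2))
                                    (cong (2 ^ positives cs +_) (sym (+-identityʳ _)))
... | suc (suc zero)    | _ = trans (cong (withMinimum 2 (sum (cs ∷ʳ 1))) (unimodalArrangements-∷ʳ-1 cs cs≤2))
                                    (cong (2 ^ positives cs +_) (sym (+-identityʳ _)))
... | suc (suc (suc _)) | s≤s (s≤s ())

positives+twos : (cs : List ℕ) → All (_≤ 2) cs → positives cs + (∑[ c ∈ cs ] 𝟙 (c ≟ 2)) ≡ sum cs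
positives+twos []       _            = refl
positives+twos (c ∷ cs) (c≤2 ∷ cs≤2) =
  trans (interchange (𝟙 (0 <? c)) (positives cs) (𝟙 (c ≟ 2)) _) (cong₂ _+_ (single c c≤2) (positives+twos cs cs≤2))
  where
  single : ∀ c → c ≤ 2 → 𝟙 (0 <? c) + 𝟙 (c ≟ 2) ≡ c
  single zero                _ = refl
  single (suc zero)          _ = refl
  single (suc (suc zero))    _ = refl
  single (suc (suc (suc _))) (s≤s (s≤s ()))


length-levels : (n : ℕ) (σ : List ℕ) → length σ ≡ n → length (levels (upTo n , σ)) ≡ n
length-levels n σ len = trans (length-zipWith _⊔_ (upTo n) σ) (trans (cong₂ _⊓_ (length-upTo n) len) (⊓-idem n))

levels-bounded : (n : ℕ) {σ : List ℕ} → All (_< n) σ → All (_< n) (levels (upTo n , σ))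
levels-bounded n = zipWith-bounded (upTo-bounded n)
  where
  zipWith-bounded : ∀ {xs ys} → All (_< n) xs → All (_< n) ys → All (_< n) (zipWith _⊔_ xs ys)
  zipWith-bounded []             _              = []
  zipWith-bounded (_ ∷ _)        []             = []
  zipWith-bounded (x<n ∷ xs<n) (y<n ∷ ys<n) = subst (_ <_) (⊔-idem n) (⊔-mono-< x<n y<n) ∷ zipWith-bounded xs<n ys<n

-- Each level value is attained at most once as an index and at most once as a value of σ.
occ-levels≤2 : (n : ℕ) {σ : List ℕ} → Unique σ → (v : ℕ) → occ v (levels (upTo n , σ)) ≤ 2
occ-levels≤2 n {σ} u v = ≤-trans (occ-zipWith-⊔ v (upTo n) σ) (+-mono-≤ (occ-Unique v (Unique.upTo⁺ n)) (occ-Unique v u))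

∑-unimodal-canonical : (n : ℕ) {σ : List ℕ} → σ ∈ Sn n →
  ∑[ p ∈ Sn n ] unimodal𝟙 (map (at (levels (upTo n , σ))) p) ≡ unimodalArrangements (multiplicities n (levels (upTo n , σ)))
∑-unimodal-canonical n {σ} σ∈ = ∑-unimodal-relabelled-permutations n (levels (upTo n , σ))
  (length-levels n σ (length≡ π)) (levels-bounded n (bounded π)) (occ-levels≤2 n (unique π))
  where π = ∈Sn⇒IsPermutation n σ∈

-- The last column

take-∷ʳ-at : (σ : List ℕ) (m : ℕ) → length σ ≡ suc m → σ ≡ take m σ ∷ʳ at σ m
take-∷ʳ-at (x ∷ [])     zero    _   = refl
take-∷ʳ-at (x ∷ σ)      (suc m) len = cong (x ∷_) (take-∷ʳ-at σ m (suc-injective len))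

length-∷ʳ : (τ : List ℕ) (s : ℕ) → length (τ ∷ʳ s) ≡ suc (length τ)
length-∷ʳ τ s = trans (length-++ τ) (+-comm (length τ) 1)

levels-∷ʳ : (m : ℕ) (τ : List ℕ) (s : ℕ) → length τ ≡ m →
            levels (upTo (suc m) , τ ∷ʳ s) ≡ levels (upTo m , τ) ∷ʳ (m ⊔ s)
levels-∷ʳ m τ s len = trans (cong (λ is → zipWith _⊔_ is (τ ∷ʳ s)) (sym (upTo-∷ʳ m)))
                           (zipWith-∷ʳ (upTo m) τ (trans (length-upTo m) (sym len)))
  where
  zipWith-∷ʳ : ∀ xs ys → length xs ≡ length ys → zipWith _⊔_ (xs ∷ʳ m) (ys ∷ʳ s) ≡ zipWith _⊔_ xs ys ∷ʳ (m ⊔ s)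
  zipWith-∷ʳ []       []       _   = refl
  zipWith-∷ʳ (x ∷ xs) (y ∷ ys) len = cong (x ⊔ y ∷_) (zipWith-∷ʳ xs ys (suc-injective len))

multiplicities-suc : (m : ℕ) (L : List ℕ) → multiplicities (suc m) L ≡ multiplicities m L ∷ʳ occ m L
multiplicities-suc m L = trans (cong (map (λ v → occ v L)) (sym (upTo-∷ʳ m))) (map-++ (λ v → occ v L) (upTo m) (m ∷ []))

-- If σ does not fix the last position, the maximal level m is attained there and where σ takes the value m.
unimodalArrangements-last-unfixed : (m : ℕ) {σ : List ℕ} → σ ∈ Sn (suc m) → at σ m ≢ m →
  unimodalArrangements (multiplicities (suc m) (levels (upTo (suc m) , σ))) ≡ 0
unimodalArrangements-last-unfixed m {σ} σ∈ σm≢m =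
  trans (cong unimodalArrangements (multiplicities-suc m (levels (upTo (suc m) , σ))))
        (unimodalArrangements-∷ʳ-≥2 (multiplicities m (levels (upTo (suc m) , σ))) _ m-twice)
  where
  π = ∈Sn⇒IsPermutation (suc m) σ∈
  τ = take m σ
  s = at σ m
  σ≡ : σ ≡ τ ∷ʳ s
  σ≡ = take-∷ʳ-at σ m (length≡ π)
  len-τ : length τ ≡ m
  len-τ = suc-injective (trans (sym (length-∷ʳ τ s)) (trans (cong length (sym σ≡)) (length≡ π)))
  s≤m : s ≤ m
  s≤m = ≤-pred (All.lookup (bounded π) (at-∈ σ (subst (m <_) (sym (length≡ π)) (n<1+n m))))
  m∈τ : m ∈ τ
  m∈τ with ∈-++⁻ τ (subst (m ∈_) σ≡ (∈-resp-↭ (↭-sym (IsPermutation⇒↭upTo (suc m) π)) (∈-upTo⁺ (n<1+n m))))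
  ... | inj₁ m∈     = m∈
  ... | inj₂ (here m≡s) = ⊥-elim (σm≢m (sym m≡s))
  m∈levels : m ∈ levels (upTo m , τ)
  m∈levels with ∈⇒∃at τ m∈τ
  ... | j , j<τ , τj≡m = subst (_∈ levels (upTo m , τ)) level≡m
                           (at-∈ (levels (upTo m , τ)) (subst (j <_) (sym (length-levels m τ len-τ)) j<m))
    where
    j<m : j < m
    j<m = subst (j <_) len-τ j<τ
    level≡m : at (levels (upTo m , τ)) j ≡ m
    level≡m = trans (at-levels m τ len-τ j<m) (trans (cong (j ⊔_) τj≡m) (m≤n⇒m⊔n≡n (<⇒≤ j<m)))
  m-twice : 2 ≤ occ m (levels (upTo (suc m) , σ))
  m-twice = begin
    1 + 1                                          ≤⟨ +-monoˡ-≤ 1 (occ-∈ (levels (upTo m , τ)) m∈levels) ⟩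
    occ m (levels (upTo m , τ)) + 1                ≡⟨ cong (occ m (levels (upTo m , τ)) +_) (sym (𝟙-yes (m ≟ m ⊔ s) (sym (m≥n⇒m⊔n≡m s≤m)))) ⟩
    occ m (levels (upTo m , τ)) + 𝟙 (m ≟ m ⊔ s)    ≡⟨ sym (occ-∷ʳ m (levels (upTo m , τ)) (m ⊔ s)) ⟩
    occ m (levels (upTo m , τ) ∷ʳ (m ⊔ s))         ≡⟨ cong (occ m) (sym (levels-∷ʳ m τ s len-τ)) ⟩
    occ m (levels (upTo (suc m) , τ ∷ʳ s))         ≡⟨ cong (λ σ → occ m (levels (upTo (suc m) , σ))) (sym σ≡) ⟩
    occ m (levels (upTo (suc m) , σ))              ∎
    where open ≤-Reasoning

private
  Unique-∷ʳ⁻ : (τ : List ℕ) (x : ℕ) → Unique (τ ∷ʳ x) → Unique τ × x ∉ τ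
  Unique-∷ʳ⁻ []      x _          = [] , λ ()
  Unique-∷ʳ⁻ (y ∷ τ) x (y∉ ∷ u) with Unique-∷ʳ⁻ τ x u
  ... | uτ , x∉τ = (All.++⁻ˡ τ y∉ ∷ uτ) , λ { (here refl) → last-≢ (All.++⁻ʳ τ y∉) refl ; (there x∈) → x∉τ x∈ }
    where
    last-≢ : All (λ z → y ≢ z) (x ∷ []) → y ≢ x
    last-≢ (y≢x ∷ []) = y≢x

  at-∷ʳ-length : (τ : List ℕ) (x : ℕ) → at (τ ∷ʳ x) (length τ) ≡ x
  at-∷ʳ-length []      x = refl
  at-∷ʳ-length (y ∷ τ) x = at-∷ʳ-length τ x

filter-last-fixed-↭ : (m : ℕ) → filter (λ σ → at σ m ≟ m) (Sn (suc m)) ↭ map (_∷ʳ m) (Sn m)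
filter-last-fixed-↭ m = Unique∧⊆∧⊇⇒↭
  (Unique.filter⁺ (λ σ → at σ m ≟ m) (Unique-Sn (suc m)))
  (Unique.map⁺ (λ {τ} {τ′} ≡ → proj₁ (∷ʳ-injective τ τ′ ≡)) (Unique-Sn m))
  fixed⊆ ⊆fixed
  where
  fixed⊆ : ∀ {σ} → σ ∈ filter (λ σ → at σ m ≟ m) (Sn (suc m)) → σ ∈ map (_∷ʳ m) (Sn m)
  fixed⊆ {σ} σ∈ with ∈-filter⁻ (λ σ → at σ m ≟ m) σ∈
  ... | σ∈Sn , σm≡m = subst (_∈ map (_∷ʳ m) (Sn m)) (sym σ≡) (∈-map⁺ (_∷ʳ m) (IsPermutation⇒∈Sn m πτ))
    where
    π = ∈Sn⇒IsPermutation (suc m) σ∈Sn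
    τ = take m σ
    σ≡ : σ ≡ τ ∷ʳ m
    σ≡ = trans (take-∷ʳ-at σ m (length≡ π)) (cong (τ ∷ʳ_) σm≡m)
    uτ = Unique-∷ʳ⁻ τ m (subst Unique σ≡ (unique π))
    τ<1+m : All (_< suc m) τ
    τ<1+m = All.++⁻ˡ τ (subst (All (_< suc m)) σ≡ (bounded π))
    πτ : IsPermutation m τ
    πτ = record
      { length≡ = suc-injective (trans (sym (length-∷ʳ τ m)) (trans (cong length (sym σ≡)) (length≡ π)))
      ; bounded = All.tabulate (λ x∈ → ≤∧≢⇒< (≤-pred (All.lookup τ<1+m x∈)) (λ { refl → proj₂ uτ x∈ }))
      ; unique  = proj₁ uτ
      }
  ⊆fixed : ∀ {σ} → σ ∈ map (_∷ʳ m) (Sn m) → σ ∈ filter (λ σ → at σ m ≟ m) (Sn (suc m))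
  ⊆fixed σ∈ with ∈-map⁻ (_∷ʳ m) σ∈
  ... | τ , τ∈ , refl = ∈-filter⁺ (λ σ → at σ m ≟ m) (IsPermutation⇒∈Sn (suc m) πσ)
                          (subst (λ k → at (τ ∷ʳ m) k ≡ m) (length≡ πτ) (at-∷ʳ-length τ m))
    where
    πτ = ∈Sn⇒IsPermutation m τ∈
    πσ : IsPermutation (suc m) (τ ∷ʳ m)
    πσ = record
      { length≡ = trans (length-∷ʳ τ m) (cong suc (length≡ πτ))
      ; bounded = All.++⁺ (All.map m<n⇒m<1+n (bounded πτ)) (n<1+n m ∷ [])
      ; unique  = Unique.++⁺ (unique πτ) ([] ∷ []) (λ { (x∈ , here refl) → <-irrefl refl (All.lookup (bounded πτ) x∈) })
      }

doubleLevels≡twos : (m : ℕ) (σ : List ℕ) →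
  doubleLevels m (upTo m , σ) ≡ ∑[ c ∈ multiplicities m (levels (upTo m , σ)) ] 𝟙 (c ≟ 2)
doubleLevels≡twos m σ =
  trans (length-filter≡∑𝟙 (λ v → occ v L ≟ 2) (upTo m)) (sym (∑-map (λ c → 𝟙 (c ≟ 2)) (λ v → occ v L) (upTo m)))
  where L = levels (upTo m , σ)

-- With the maximum m alone in the last column, every other value attained once or twice doubles the count.
unimodalArrangements-last-fixed : (m : ℕ) {τ : List ℕ} → τ ∈ Sn m →
  unimodalArrangements (multiplicities (suc m) (levels (upTo (suc m) , τ ∷ʳ m))) ≡ 2 ^ (m ∸ doubleLevels m (upTo m , τ))
unimodalArrangements-last-fixed m {τ} τ∈ = begin
  unimodalArrangements (multiplicities (suc m) (levels (upTo (suc m) , τ ∷ʳ m)))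
    ≡⟨ cong (unimodalArrangements ∘ multiplicities (suc m)) (trans (levels-∷ʳ m τ m (length≡ π)) (cong (L ∷ʳ_) (⊔-idem m))) ⟩
  unimodalArrangements (multiplicities (suc m) (L ∷ʳ m))
    ≡⟨ cong unimodalArrangements (multiplicities-suc m (L ∷ʳ m)) ⟩
  unimodalArrangements (multiplicities m (L ∷ʳ m) ∷ʳ occ m (L ∷ʳ m))
    ≡⟨ cong₂ (λ X c → unimodalArrangements (X ∷ʳ c)) (map-cong-local (All.tabulate (λ v∈ → occ-below (∈-upTo⁻ v∈)))) occ-top ⟩
  unimodalArrangements (X ∷ʳ 1)
    ≡⟨ unimodalArrangements-∷ʳ-1 X (All.map⁺ (All.tabulate (λ {v} _ → occ-levels≤2 m (unique π) v))) ⟩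
  2 ^ positives X
    ≡⟨ cong (2 ^_) positives≡ ⟩
  2 ^ (m ∸ doubleLevels m (upTo m , τ)) ∎
  where
  open ≡-Reasoning
  π = ∈Sn⇒IsPermutation m τ∈
  L = levels (upTo m , τ)
  X = multiplicities m L
  L<m : All (_< m) L
  L<m = levels-bounded m (bounded π)
  occ-below : ∀ {v} → v < m → occ v (L ∷ʳ m) ≡ occ v L
  occ-below {v} v<m = trans (occ-∷ʳ v L m) (trans (cong (occ v L +_) (𝟙-no (v ≟ m) (<⇒≢ v<m))) (+-identityʳ _))
  occ-top : occ m (L ∷ʳ m) ≡ 1
  occ-top = trans (occ-∷ʳ m L m) (cong₂ _+_ (occ-∉ L (λ m∈ → <-irrefl refl (All.lookup L<m m∈))) (𝟙-yes (m ≟ m) refl))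
  positives≡ : positives X ≡ m ∸ doubleLevels m (upTo m , τ)
  positives≡ = begin
    positives X                                                   ≡⟨ sym (m+n∸n≡m (positives X) (∑[ c ∈ X ] 𝟙 (c ≟ 2))) ⟩
    positives X + (∑[ c ∈ X ] 𝟙 (c ≟ 2)) ∸ (∑[ c ∈ X ] 𝟙 (c ≟ 2)) ≡⟨ cong₂ _∸_ sum≡m (sym (doubleLevels≡twos m τ)) ⟩
    m ∸ doubleLevels m (upTo m , τ)                               ∎
    where
    sum≡m : positives X + (∑[ c ∈ X ] 𝟙 (c ≟ 2)) ≡ m
    sum≡m = trans (positives+twos X (All.map⁺ (All.tabulate (λ {v} _ → occ-levels≤2 m (unique π) v))))
                  (trans (∑-occ-upTo m L L<m) (length-levels m τ (length≡ π)))

∑-by-doubleLevels : (m : ℕ) →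
  ∑[ τ ∈ Sn m ] 2 ^ (m ∸ doubleLevels m (upTo m , τ)) ≡ ∑[ k ∈ upTo (suc m) ] 2 ^ (suc m ∸ k ∸ 1) * R m k
∑-by-doubleLevels m = sym (begin
  ∑[ k ∈ upTo (suc m) ] 2 ^ (suc m ∸ k ∸ 1) * R m k
    ≡⟨ ∑-cong (upTo (suc m)) (λ {k} _ → cong₂ _*_ (cong (2 ^_) (exponent k)) (R≡ k)) ⟩
  ∑[ k ∈ upTo (suc m) ] 2 ^ (m ∸ k) * (∑[ τ ∈ Sn m ] 𝟙 (d τ ≟ k))
    ≡⟨ ∑-cong (upTo (suc m)) (λ {k} _ → *-distribˡ-∑ (2 ^ (m ∸ k)) (λ τ → 𝟙 (d τ ≟ k)) (Sn m)) ⟩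
  ∑[ k ∈ upTo (suc m) ] ∑[ τ ∈ Sn m ] 2 ^ (m ∸ k) * 𝟙 (d τ ≟ k)
    ≡⟨ ∑-comm (λ k τ → 2 ^ (m ∸ k) * 𝟙 (d τ ≟ k)) (upTo (suc m)) (Sn m) ⟩
  ∑[ τ ∈ Sn m ] ∑[ k ∈ upTo (suc m) ] 2 ^ (m ∸ k) * 𝟙 (d τ ≟ k)
    ≡⟨ ∑-cong (Sn m) (λ {τ} _ → ∑-upTo-𝟙≟ (λ k → 2 ^ (m ∸ k)) (s≤s (d≤m τ))) ⟩
  ∑[ τ ∈ Sn m ] 2 ^ (m ∸ d τ) ∎)
  where
  open ≡-Reasoning
  d : List ℕ → ℕ
  d τ = doubleLevels m (upTo m , τ)
  exponent : ∀ k → suc m ∸ k ∸ 1 ≡ m ∸ k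
  exponent zero    = refl
  exponent (suc k) = trans (∸-+-assoc m k 1) (cong (m ∸_) (+-comm k 1))
  R≡ : ∀ k → R m k ≡ ∑[ τ ∈ Sn m ] 𝟙 (d τ ≟ k)
  R≡ k = trans (length-filter≡∑𝟙 (λ Π → doubleLevels m Π ≟ k) (canonical m))
               (∑-map (λ Π → 𝟙 (doubleLevels m Π ≟ k)) (upTo m ,_) (Sn m))
  d≤m : ∀ τ → d τ ≤ m
  d≤m τ = subst (d τ ≤_) (length-upTo m) (length-filter (λ v → occ v (levels (upTo m , τ)) ≟ 2) (upTo m))

theorem3p12 : (m : ℕ) → U (suc m) ≡ sum (map (λ k → 2 ^ (suc m ∸ k ∸ 1) * R m k) (upTo (suc m)))
theorem3p12 m = begin
  U (suc m)                                                ≡⟨ U≡∑-canonical (suc m) ⟩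
  ∑[ σ ∈ Sn (suc m) ] ∑[ p ∈ Sn (suc m) ] unimodal𝟙 (map (at (levels (upTo (suc m) , σ))) p)
                                                           ≡⟨ ∑-cong (Sn (suc m)) (∑-unimodal-canonical (suc m)) ⟩
  ∑ N (Sn (suc m))                                         ≡⟨ ∑-filter (λ σ → at σ m ≟ m) N (Sn (suc m)) (unimodalArrangements-last-unfixed m) ⟩
  ∑ N (filter (λ σ → at σ m ≟ m) (Sn (suc m)))             ≡⟨ ∑-↭ N (filter-last-fixed-↭ m) ⟩
  ∑ N (map (_∷ʳ m) (Sn m))                                 ≡⟨ ∑-map N (_∷ʳ m) (Sn m) ⟩
  ∑[ τ ∈ Sn m ] N (τ ∷ʳ m)                                 ≡⟨ ∑-cong (Sn m) (unimodalArrangements-last-fixed m) ⟩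
  ∑[ τ ∈ Sn m ] 2 ^ (m ∸ doubleLevels m (upTo m , τ))      ≡⟨ ∑-by-doubleLevels m ⟩
  ∑[ k ∈ upTo (suc m) ] 2 ^ (suc m ∸ k ∸ 1) * R m k        ∎
  where
  open ≡-Reasoning
  N : List ℕ → ℕ
  N σ = unimodalArrangements (multiplicities (suc m) (levels (upTo (suc m) , σ)))
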